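{- There exists an infinite family of strings $w$, with lengths $n=|w|$ unbounded over the family, such that $\liminf_{n\to\infty} z(w^R)/z(w)=3$. The same holds with $z$ replaced by $z_{no}$.
   Context: For $w=w[1]\cdots w[n]$, $w^R=w[n]\cdots w[1]$. The Lempel–Ziv parse of $w$ is the factorization $w=x_1\cdots x_z$ in which, for each $j$, the phrase $x_j$ is the longest prefix of $x_j\cdots x_z$ that has another occurrence in $w$ starting at a position $i\le |x_1\cdots x_{j-1}|$ (sources may overlap the phrase); if no nonempty such prefix exists, $x_j$ is a single character (its first occurrence). $z(w)$ is the number of phrases. $z_{no}(w)$ is the number of phrases of the analogous greedy parse in which, additionally, the source occurrence of each phrase must not overlap the phrase (i.e., it must lie entirely within $x_1\cdots x_{j-1}$). -}

module Defs where

open import Data.Nat using (ℕ; zero; suc; _+_; _*_; _∸_; _≤_; _<_; _⊔_; _⊓_; _≟_; _<ᵇ_)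
open import Data.List using (List; []; _∷_; length; drop; map; foldr; upTo; reverse)
open import Data.Bool using (if_then_else_)
open import Data.Product using (∃-syntax; _×_)
open import Relation.Nullary using (yes; no)

-- Strings are lists over the alphabet ℕ (0-indexed positions).
Str : Set
Str = List ℕ

rev : Str → Str
rev = reverse

lcp : Str → Str → ℕ
lcp (x ∷ xs) (y ∷ ys) with x ≟ y
... | yes _ = suc (lcp xs ys)
... | no  _ = 0
lcp _ _ = 0

-- Longest prefix of w[p..] that also occurs starting at some position s < p
-- (0-indexed; i.e. the paper's 1-indexed source position i ≤ p, i ≠ p+1).
-- Overlapping sources allowed: the longest match from s is lcp (drop s w) (drop p w).
longestSrc : Str → ℕ → ℕ
longestSrc w p = foldr _⊔_ 0 (map (λ s → lcp (drop s w) (drop p w)) (upTo p))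

-- Non-overlapping variant: source w[s..s+ℓ) must lie inside w[0..p), i.e. s + ℓ ≤ p.
longestSrcNo : Str → ℕ → ℕ
longestSrcNo w p = foldr _⊔_ 0 (map (λ s → lcp (drop s w) (drop p w) ⊓ (p ∸ s)) (upTo p))

-- Greedy parse: phrase length is the longest source match, or 1 if there is none.
-- The fuel argument (initially |w|) suffices since every phrase has length ≥ 1.
countPhrases : (Str → ℕ → ℕ) → Str → ℕ → ℕ → ℕ
countPhrases L w zero p = 0
countPhrases L w (suc f) p =
  if p <ᵇ length w
  then suc (countPhrases L w f (p + (1 ⊔ L w p)))
  else 0

z : Str → ℕ
z w = countPhrases longestSrc w (length w) 0

zno : Str → ℕ
zno w = countPhrases longestSrcNo w (length w) 0

-- liminf_{k→∞} a k / b k = c  (for b k ≥ 1), written with ε = 1/m, m ≥ 1: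
--  * ∀ m ≥ 1, eventually a k / b k ≥ c - 1/m   i.e.  (c·m - 1)·b k ≤ m·a k
--  * ∀ m ≥ 1, infinitely often a k / b k ≤ c + 1/m   i.e.  m·a k ≤ (c·m + 1)·b k
LiminfRatio : (ℕ → ℕ) → (ℕ → ℕ) → ℕ → Set
LiminfRatio a b c =
  (∀ m → 1 ≤ m → ∃[ K ] ∀ k → K ≤ k → (c * m ∸ 1) * b k ≤ m * a k) ×
  (∀ m → 1 ≤ m → ∀ K → ∃[ k ] (K ≤ k × m * a k ≤ (c * m + 1) * b k))

-- An infinite family of strings, indexed by k, with strictly increasing lengths
-- (so n = |w_k| → ∞), along which liminf z'(w^R)/z'(w) = 3.
-- (Positivity of z' on nonempty strings makes the ratios well defined.)
Witness : (Str → ℕ) → (ℕ → Str) → Set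
Witness zz f =
  (∀ k → length (f k) < length (f (suc k))) ×
  (∀ k → 1 ≤ zz (f k)) ×
  LiminfRatio (λ k → zz (rev (f k))) (λ k → zz (f k)) 3

{-# OPTIONS --safe #-}
-- Blocks (r , c) stand for the letter intervals [c − r, c + r]. Phase i contributes the radii
-- 2^i ≤ r < 2^(i+1), each with the centres at the positive multiples of 2^(i+1) below N = 2^(n+3);
-- with n phases there are about 4n·2^n blocks. The string w is the run 0 1 … N followed by the
-- ascending runs of the blocks, largest first. Each run is a factor of 0 … N, so z(w) is at most
-- N + 1 plus the number of blocks; the junctions between runs are bigrams occurring only once, so
-- it is at least the number of blocks minus one. In the reversal the blocks come smallest first, as
-- descending runs, and each costs exactly three phrases. At most three: shortened by one letter, the
-- halves [c − r + 1, c] and [c + 1, c + r] lie in the earlier blocks (r − 1, c) and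
-- (2^i − 1, c + 2^i). At least three: the junction is new, and neither [c − r, c] nor [c, c + r] lies
-- in an earlier block, since an earlier block of phase at most i containing c is centred at c and
-- smaller. As N is negligible against the number of blocks, the ratio tends to 3. All bounds hold
-- for z and z_no alike: the copies used have non-overlapping sources, and the lower bounds only
-- use that a phrase never outruns the longest earlier match.

module Submission where

open import Defs
open import Data.Bool using (true; false)
open import Data.Empty using (⊥; ⊥-elim)
open import Data.List using (List; []; _∷_; _++_; [_]; length; drop; take; map; foldr; upTo; concatMap; reverse)
open import Data.List.Properties
  using (drop-drop; ∷-injective; ∷ʳ-injective; length-++; length-++-≤ˡ; ++-assoc; ++-identityʳ; reverse-++; unfold-reverse;
         reverse-involutive; concatMap-++; length-reverse; length-map; length-upTo; upTo-∷ʳ)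
open import Data.List.Membership.Propositional using (_∈_; _∉_; find; lose)
open import Data.List.Membership.Propositional.Properties
  using (∈-map⁺; ∈-map⁻; ∈-upTo⁺; ∈-upTo⁻; ∈-++⁺ʳ; ∈-++⁻; ∈-∃++; ∈-concatMap⁺; ∈-concatMap⁻)
open import Data.List.Relation.Unary.Any using (here; there)
open import Data.List.Relation.Unary.Any.Properties using (reverse⁺; reverse⁻)
open import Data.List.Relation.Unary.AllPairs using (AllPairs; []; _∷_)
import Data.List.Relation.Unary.AllPairs.Properties as AllPairs
import Data.List.Relation.Unary.All as All
import Data.List.Relation.Unary.All.Properties as All
open import Data.Nat
open import Data.Nat.Properties
open import Data.Nat.Divisibility using (_∣_; n∣m*n; m∣m*n; ∣-trans; ∣m+n∣m⇒∣n; >⇒∤)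
open import Data.Nat.Solver using (module +-*-Solver)
open import Data.Product using (Σ; ∃; ∃₂; ∃-syntax; _×_; _,_; proj₁; proj₂)
open import Data.Product.Relation.Binary.Lex.Strict using (×-Lex; ×-transitive; ×-irreflexive; ×-compare)
open import Data.Product.Relation.Binary.Pointwise.NonDependent using (≡×≡⇒≡)
open import Data.Sum using (_⊎_; inj₁; inj₂)
open import Function using (_∘_; _∘′_; case_of_)
open import Level using (0ℓ)
open import Relation.Binary using (Rel; Transitive; tri<; tri≈; tri>)
open import Relation.Nullary using (¬_; yes; no; ofʸ; ofⁿ; contradiction)
open import Relation.Binary.PropositionalEquality hiding ([_])


lcp-∷-≡ : ∀ x xs ys → lcp (x ∷ xs) (x ∷ ys) ≡ suc (lcp xs ys)
lcp-∷-≡ x xs ys with x ≟ x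
... | yes _ = refl
... | no x≢x = contradiction refl x≢x

lcp-drop : ∀ d xs ys → lcp xs ys ∸ d ≤ lcp (drop d xs) (drop d ys)
lcp-drop zero xs ys = ≤-refl
lcp-drop (suc d) [] ys = z≤n
lcp-drop (suc d) (x ∷ xs) [] = z≤n
lcp-drop (suc d) (x ∷ xs) (y ∷ ys) with x ≟ y
... | yes _ = lcp-drop d xs ys
... | no _ = z≤n

length≤lcp-++ : ∀ us xs ys → length us ≤ lcp (us ++ xs) (us ++ ys)
length≤lcp-++ [] xs ys = z≤n
length≤lcp-++ (u ∷ us) xs ys rewrite lcp-∷-≡ u (us ++ xs) (us ++ ys) = s≤s (length≤lcp-++ us xs ys)

take-≡-≤lcp : ∀ ℓ xs ys → ℓ ≤ lcp xs ys → take ℓ xs ≡ take ℓ ys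
take-≡-≤lcp zero xs ys _ = refl
take-≡-≤lcp (suc ℓ) (x ∷ xs) (y ∷ ys) ℓ<lcp with x ≟ y
take-≡-≤lcp (suc ℓ) (x ∷ xs) (y ∷ ys) (s≤s ℓ≤lcp) | yes refl = cong (x ∷_) (take-≡-≤lcp ℓ xs ys ℓ≤lcp)

lce : Str → ℕ → ℕ → ℕ
lce w s p = lcp (drop s w) (drop p w)

lce-shift : ∀ w s p d → lce w s p ∸ d ≤ lce w (s + d) (p + d)
lce-shift w s p d rewrite sym (drop-drop s d w) | sym (drop-drop p d w) = lcp-drop d (drop s w) (drop p w)

lce-≥-shared-prefix : ∀ {w s p} us {xs ys} → drop s w ≡ us ++ xs → drop p w ≡ us ++ ys → length us ≤ lce w s p
lce-≥-shared-prefix us {xs} {ys} ds dp = subst (length us ≤_) (sym (cong₂ lcp ds dp)) (length≤lcp-++ us xs ys)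

record IsPhraseLength (L : Str → ℕ → ℕ) : Set where
  field
    ≥-nonOverlapping : ∀ w {p s} → s < p → lce w s p ⊓ (p ∸ s) ≤ L w p
    ≤-overlapping    : ∀ w {p m} → (∀ {s} → s < p → lce w s p ≤ m) → L w p ≤ m

foldr-⊔-upper : ∀ {x} xs → x ∈ xs → x ≤ foldr _⊔_ 0 xs
foldr-⊔-upper (y ∷ ys) (here refl) = m≤m⊔n y _
foldr-⊔-upper (y ∷ ys) (there x∈ys) = ≤-trans (foldr-⊔-upper ys x∈ys) (m≤n⊔m y _)

foldr-⊔-least : ∀ xs {m} → (∀ {x} → x ∈ xs → x ≤ m) → foldr _⊔_ 0 xs ≤ m
foldr-⊔-least [] _ = z≤n
foldr-⊔-least (y ∷ ys) ub = ⊔-lub (ub (here refl)) (foldr-⊔-least ys (ub ∘′ there))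

module _ (len : Str → ℕ → ℕ → ℕ) (w : Str) (p : ℕ) where

  maxOver-upper : ∀ {s} → s < p → len w s p ≤ foldr _⊔_ 0 (map (λ s → len w s p) (upTo p))
  maxOver-upper s<p = foldr-⊔-upper _ (∈-map⁺ (λ s → len w s p) (∈-upTo⁺ s<p))

  maxOver-least : ∀ {m} → (∀ {s} → s < p → len w s p ≤ m) → foldr _⊔_ 0 (map (λ s → len w s p) (upTo p)) ≤ m
  maxOver-least ub = foldr-⊔-least _ λ x∈ → case ∈-map⁻ (λ s → len w s p) x∈ of λ where
    (s , s∈ , refl) → ub (∈-upTo⁻ s∈)

isPhraseLength-longestSrc : IsPhraseLength longestSrc
isPhraseLength-longestSrc = record
  { ≥-nonOverlapping = λ w {p} s<p → ≤-trans (m⊓n≤m _ _) (maxOver-upper lce w p s<p)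
  ; ≤-overlapping    = λ w {p} → maxOver-least lce w p
  }

isPhraseLength-longestSrcNo : IsPhraseLength longestSrcNo
isPhraseLength-longestSrcNo = record
  { ≥-nonOverlapping = λ w {p} → maxOver-upper (λ w s p → lce w s p ⊓ (p ∸ s)) w p
  ; ≤-overlapping    = λ w {p} ub → maxOver-least (λ w s p → lce w s p ⊓ (p ∸ s)) w p (λ s<p → ≤-trans (m⊓n≤m _ _) (ub s<p))
  }

module Parsing (w : Str) where

  -- A parse of w from position p; sources may not overlap their copies, so it bounds z and z_no alike.
  data Factorization (p : ℕ) : Set where
    done   : length w ≤ p → Factorization p
    letter : Factorization (suc p) → Factorization p
    copy   : ∀ ℓ s → s + ℓ ≤ p → ℓ ≤ lce w s p → Factorization (p + ℓ) → Factorization p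

  size : ∀ {p} → Factorization p → ℕ
  size (done _) = 0
  size (letter φ) = suc (size φ)
  size (copy _ _ _ _ φ) = suc (size φ)

  size-subst : ∀ {p q} (p≡q : p ≡ q) (φ : Factorization p) → size (subst Factorization p≡q φ) ≡ size φ
  size-subst refl φ = refl

  letters : ∀ {p} m → (φ : Factorization (p + m)) → Σ (Factorization p) λ ψ → size ψ ≡ m + size φ
  letters {p} zero φ = subst Factorization (+-identityʳ p) φ , size-subst (+-identityʳ p) φ
  letters {p} (suc m) φ with letters {suc p} m (subst Factorization (+-suc p m) φ)
  ... | ψ , size≡ = letter ψ , cong suc (trans size≡ (cong (m +_) (size-subst (+-suc p m) φ)))

  -- w[i..j] (both ends included) has no occurrence starting before i.
  Novel : ℕ → ℕ → Set
  Novel i j = ∀ {s} → s < i → lce w s i ≤ j ∸ i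

  no-earlier-occurrence⇒Novel : ∀ {i} m → (∀ {s} → s < i → take (suc m) (drop s w) ≢ take (suc m) (drop i w)) → Novel i (i + m)
  no-earlier-occurrence⇒Novel {i} m no-occ {s} s<i with lce w s i ≤? m
  ... | yes ≤ = subst (lce w s i ≤_) (sym (m+n∸m≡n i m)) ≤
  ... | no ≰ = contradiction (take-≡-≤lcp (suc m) (drop s w) (drop i w) (≰⇒> ≰)) (no-occ s<i)

  infixr 5 _∷_
  data NovelWindows : ℕ → ℕ → Set where
    []  : ∀ {p} → NovelWindows p 0
    _∷_ : ∀ {p k i j} → (p ≤ i × i < j × j < length w × Novel i j) → NovelWindows j k → NovelWindows p (suc k)

  weaken : ∀ {p p' k} → p' ≤ p → NovelWindows p k → NovelWindows p' k
  weaken p'≤p [] = []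
  weaken p'≤p ((p≤i , rest) ∷ ws) = (≤-trans p'≤p p≤i , rest) ∷ ws


module Greedy {L : Str → ℕ → ℕ} (isPL : IsPhraseLength L) (w : Str) where
  open IsPhraseLength isPL
  open Parsing w public

  phrases : ℕ → ℕ → ℕ
  phrases = countPhrases L w

  next : ℕ → ℕ
  next p = p + (1 ⊔ L w p)

  p<next : ∀ p → p < next p
  p<next p = subst (_≤ next p) (+-comm p 1) (+-monoʳ-≤ p (m≤m⊔n 1 (L w p)))

  phrases-end : ∀ f {p} → length w ≤ p → phrases f p ≡ 0
  phrases-end zero _ = refl
  phrases-end (suc f) {p} w≤p with p <ᵇ length w | <ᵇ-reflects-< p (length w)
  ... | false | _ = refl
  ... | true | ofʸ p<w = contradiction w≤p (<⇒≱ p<w)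

  phrases-step : ∀ f {p} → p < length w → phrases (suc f) p ≡ suc (phrases f (next p))
  phrases-step f {p} p<w with p <ᵇ length w | <ᵇ-reflects-< p (length w)
  ... | true | _ = refl
  ... | false | ofⁿ p≮w = contradiction p<w p≮w

  phrases-end-≤ : ∀ f {p m} → length w ≤ p → phrases f p ≤ m
  phrases-end-≤ f w≤p = ≤-trans (≤-reflexive (phrases-end f w≤p)) z≤n

  -- The copied text is still available, from the shifted source, to a phrase starting d letters later.
  copy-suffix≤L : ∀ {ℓ s p} → s + ℓ ≤ p → ℓ ≤ lce w s p → ∀ {d} → d < ℓ → ℓ ∸ d ≤ L w (p + d)
  copy-suffix≤L {ℓ} {s} {p} sℓ≤p ℓ≤lce {d} d<ℓ =
    ≤-trans (⊓-glb fromLce fromGap) (≥-nonOverlapping w (+-monoˡ-< d s<p))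
    where
      s<p : s < p
      s<p = ≤-<-trans (m≤m+n s d) (<-≤-trans (+-monoʳ-< s d<ℓ) sℓ≤p)
      fromLce : ℓ ∸ d ≤ lce w (s + d) (p + d)
      fromLce = ≤-trans (∸-monoˡ-≤ d ℓ≤lce) (lce-shift w s p d)
      fromGap : ℓ ∸ d ≤ (p + d) ∸ (s + d)
      fromGap = begin
        ℓ ∸ d             ≤⟨ m∸n≤m ℓ d ⟩
        ℓ                 ≤⟨ m+n≤o⇒m≤o∸n ℓ (subst (_≤ p) (+-comm s ℓ) sℓ≤p) ⟩
        p ∸ s             ≡⟨ sym ([m+o]∸[n+o]≡m∸n p s d) ⟩
        (p + d) ∸ (s + d) ∎
        where
          open ≤-Reasoning
          [m+o]∸[n+o]≡m∸n : ∀ m n o → (m + o) ∸ (n + o) ≡ m ∸ n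
          [m+o]∸[n+o]≡m∸n m n o = trans (cong₂ _∸_ (+-comm m o) (+-comm n o)) ([m+n]∸[m+o]≡n∸o o m n)

  next-≥-end-of-copy : ∀ {ℓ s p q} → s + ℓ ≤ p → ℓ ≤ lce w s p → p ≤ q → q < p + ℓ → p + ℓ ≤ next q
  next-≥-end-of-copy {ℓ} {s} {p} {q} sℓ≤p ℓ≤lce p≤q q<pℓ = begin
    p + ℓ             ≡⟨ cong (p +_) (sym (m+[n∸m]≡n (<⇒≤ d<ℓ))) ⟩
    p + (d + (ℓ ∸ d)) ≡⟨ sym (+-assoc p d (ℓ ∸ d)) ⟩
    p + d + (ℓ ∸ d)   ≡⟨ cong (_+ (ℓ ∸ d)) q≡p+d ⟩
    q + (ℓ ∸ d)       ≤⟨ +-monoʳ-≤ q (≤-trans suffix≤L (m≤n⊔m 1 (L w q))) ⟩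
    next q            ∎
    where
      open ≤-Reasoning
      d = q ∸ p
      q≡p+d : p + d ≡ q
      q≡p+d = m+[n∸m]≡n p≤q
      d<ℓ : d < ℓ
      d<ℓ = +-cancelˡ-< p d ℓ (subst (_< p + ℓ) (sym q≡p+d) q<pℓ)
      suffix≤L : ℓ ∸ d ≤ L w q
      suffix≤L = subst (λ x → ℓ ∸ d ≤ L w x) q≡p+d (copy-suffix≤L sℓ≤p ℓ≤lce d<ℓ)

  greedy≤size : ∀ {p} (φ : Factorization p) f q → p ≤ q → phrases f q ≤ size φ
  greedy≤size φ zero q _ = z≤n
  greedy≤size (done w≤p) (suc f) q p≤q = phrases-end-≤ (suc f) (≤-trans w≤p p≤q)
  greedy≤size {p} (letter φ) (suc f) q p≤q with p <? q
  ... | yes p<q = m≤n⇒m≤1+n (greedy≤size φ (suc f) q p<q)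
  ... | no p≮q with ≤-antisym p≤q (≮⇒≥ p≮q)
  ...   | refl with p <? length w
  ...     | no p≮w = phrases-end-≤ (suc f) (≮⇒≥ p≮w)
  ...     | yes p<w rewrite phrases-step f p<w = s≤s (greedy≤size φ f (next p) (p<next p))
  greedy≤size {p} (copy ℓ s sℓ≤p ℓ≤lce φ) (suc f) q p≤q with p + ℓ ≤? q
  ... | yes pℓ≤q = m≤n⇒m≤1+n (greedy≤size φ (suc f) q pℓ≤q)
  ... | no pℓ≰q with q <? length w
  ...   | no q≮w = phrases-end-≤ (suc f) (≮⇒≥ q≮w)
  ...   | yes q<w rewrite phrases-step f q<w =
          s≤s (greedy≤size φ f (next q) (next-≥-end-of-copy sℓ≤p ℓ≤lce p≤q (≰⇒> pℓ≰q)))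

  -- A match from before p that ran past j would, shifted to i, be an earlier occurrence of w[i..j].
  lce≤-before-window : ∀ {p i j} → p ≤ i → i ≤ j → Novel i j → ∀ {s} → s < p → lce w s p ≤ j ∸ p
  lce≤-before-window {p} {i} {j} p≤i i≤j novel {s} s<p = begin
    lce w s p                 ≤⟨ m≤n+m∸n (lce w s p) d ⟩
    d + (lce w s p ∸ d)       ≤⟨ +-monoʳ-≤ d (≤-trans (lce-shift w s p d) (≤-reflexive (cong (lce w (s + d)) p+d≡i))) ⟩
    d + lce w (s + d) i       ≤⟨ +-monoʳ-≤ d (novel (subst (s + d <_) p+d≡i (+-monoˡ-< d s<p))) ⟩
    d + (j ∸ i)               ≡⟨ +-comm d (j ∸ i) ⟩
    (j ∸ i) + (i ∸ p)         ≡⟨ sym (+-∸-assoc (j ∸ i) p≤i) ⟩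
    ((j ∸ i) + i) ∸ p         ≡⟨ cong (_∸ p) (m∸n+n≡m i≤j) ⟩
    j ∸ p                     ∎
    where
      open ≤-Reasoning
      d = i ∸ p
      p+d≡i : p + d ≡ i
      p+d≡i = m+[n∸m]≡n p≤i

  fuel-next : ∀ {f} p → length w ∸ p ≤ suc f → length w ∸ next p ≤ f
  fuel-next {f} p fuel =
    ≤-trans (∸-monoʳ-≤ (length w) (p<next p)) (subst (_≤ f) (pred[m∸n]≡m∸[1+n] (length w) p) (pred-mono-≤ fuel))

  windows≤greedy : ∀ f p {k} → NovelWindows p k → length w ∸ p ≤ f → k ≤ phrases f p
  windows≤greedy f p [] _ = z≤n
  windows≤greedy zero p ((p≤i , i<j , j<w , _) ∷ _) fuel =
    contradiction fuel (<⇒≱ (m<n⇒0<n∸m (≤-<-trans p≤i (<-trans i<j j<w))))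
  windows≤greedy (suc f) p (_∷_ {i = i} {j} (p≤i , i<j , j<w , novel) ws) fuel
    rewrite phrases-step f (≤-<-trans p≤i (<-trans i<j j<w)) with next p ≤? i
  ... | yes next≤i = m≤n⇒m≤1+n (windows≤greedy f (next p) ((next≤i , i<j , j<w , novel) ∷ ws) (fuel-next p fuel))
  ... | no _ = s≤s (windows≤greedy f (next p) (weaken next≤j ws) (fuel-next p fuel))
    where
      p<j : p < j
      p<j = ≤-<-trans p≤i i<j
      next≤j : next p ≤ j
      next≤j = subst (next p ≤_) (m+[n∸m]≡n (<⇒≤ p<j))
        (+-monoʳ-≤ p (⊔-lub (m<n⇒0<n∸m p<j) (≤-overlapping w (lce≤-before-window p≤i (<⇒≤ i<j) novel))))

  1≤phrases : 0 < length w → 1 ≤ phrases (length w) 0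
  1≤phrases 0<w = subst (λ f → 1 ≤ phrases f 0) (suc-pred (length w) {{>-nonZero 0<w}})
    (subst (1 ≤_) (sym (phrases-step (pred (length w)) 0<w)) (s≤s z≤n))

desc : ℕ → ℕ → List ℕ
desc b zero = b ∷ []
desc b (suc d) = suc (b + d) ∷ desc b d

asc : ℕ → ℕ → List ℕ
asc b zero = b ∷ []
asc b (suc d) = b ∷ asc (suc b) d

length-desc : ∀ b d → length (desc b d) ≡ suc d
length-desc b zero = refl
length-desc b (suc d) = cong suc (length-desc b d)

length-asc : ∀ b d → length (asc b d) ≡ suc d
length-asc b zero = refl
length-asc b (suc d) = cong suc (length-asc (suc b) d)

desc-head : ∀ b d → ∃ λ xs → desc b d ≡ b + d ∷ xs
desc-head b zero = [] , cong (_∷ []) (sym (+-identityʳ b))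
desc-head b (suc d) = desc b d , cong (_∷ desc b d) (sym (+-suc b d))

asc-head : ∀ b d → ∃ λ xs → asc b d ≡ b ∷ xs
asc-head b zero = [] , refl
asc-head b (suc d) = asc (suc b) d , refl

drop-desc : ∀ k b e → drop k (desc b (k + e)) ≡ desc b e
drop-desc zero b e = refl
drop-desc (suc k) b e = drop-desc k b e

drop-desc-all : ∀ b d → drop d (desc b d) ≡ b ∷ []
drop-desc-all b zero = refl
drop-desc-all b (suc d) = drop-desc-all b d

drop-asc-all : ∀ b d → drop d (asc b d) ≡ b + d ∷ []
drop-asc-all b zero = cong (_∷ []) (sym (+-identityʳ b))
drop-asc-all b (suc d) = trans (drop-asc-all (suc b) d) (cong (_∷ []) (sym (+-suc b d)))

drop-asc : ∀ k b e → drop k (asc b (k + e)) ≡ asc (k + b) e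
drop-asc zero b e = refl
drop-asc (suc k) b e = trans (drop-asc k (suc b) e) (cong (λ x → asc x e) (+-suc k b))

desc-++ : ∀ b d e → desc b (d + suc e) ≡ desc (b + suc e) d ++ desc b e
desc-++ b zero e = cong (_∷ desc b e) (sym (+-suc b e))
desc-++ b (suc d) e =
  cong₂ _∷_ (cong suc (trans (cong (b +_) (+-comm d (suc e))) (sym (+-assoc b (suc e) d)))) (desc-++ b d e)

asc-++ : ∀ b d e → asc b (d + suc e) ≡ asc b d ++ asc (b + suc d) e
asc-++ b zero e = cong (λ x → b ∷ asc x e) (+-comm 1 b)
asc-++ b (suc d) e = cong (b ∷_) (trans (asc-++ (suc b) d e) (cong (λ x → asc (suc b) d ++ asc x e) (sym (+-suc b (suc d)))))

reverse-desc : ∀ b d → reverse (desc b d) ≡ asc b d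
reverse-desc b zero = refl
reverse-desc b (suc d) = begin
  reverse (desc b (suc d))               ≡⟨ unfold-reverse (suc (b + d)) (desc b d) ⟩
  reverse (desc b d) ++ [ suc (b + d) ]  ≡⟨ cong₂ (λ xs x → xs ++ [ x ]) (reverse-desc b d) (sym (+-suc b d)) ⟩
  asc b d ++ asc (b + suc d) 0           ≡⟨ sym (asc-++ b d 0) ⟩
  asc b (d + 1)                          ≡⟨ cong (asc b) (+-comm d 1) ⟩
  asc b (suc d)                          ∎
  where open ≡-Reasoning

drop-++ˡ : ∀ {A : Set} k (xs ys : List A) → k ≤ length xs → drop k (xs ++ ys) ≡ drop k xs ++ ys
drop-++ˡ zero xs ys _ = refl
drop-++ˡ (suc k) (x ∷ xs) ys (s≤s k≤xs) = drop-++ˡ k xs ys k≤xs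

drop-++ʳ : ∀ {A : Set} k (xs ys : List A) → drop (length xs + k) (xs ++ ys) ≡ drop k ys
drop-++ʳ k [] ys = refl
drop-++ʳ k (x ∷ xs) ys = drop-++ʳ k xs ys

drop-++-length : ∀ {A : Set} (xs ys : List A) → drop (length xs) (xs ++ ys) ≡ ys
drop-++-length [] ys = refl
drop-++-length (x ∷ xs) ys = drop-++-length xs ys

take-++-length : ∀ {A : Set} (xs ys : List A) → take (length xs) (xs ++ ys) ≡ xs
take-++-length [] ys = refl
take-++-length (x ∷ xs) ys = cong (x ∷_) (take-++-length xs ys)

Consecutive : ∀ {A : Set} → List A → A → A → Set
Consecutive xs x y = ∃₂ λ before after → xs ≡ before ++ x ∷ y ∷ after

module Runs {A : Set} (run : A → List ℕ) where

  runs : List A → List ℕ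
  runs = concatMap run

  runs-split : ∀ {xs before x after} R → xs ≡ before ++ x ∷ after →
               runs xs ++ R ≡ runs before ++ (run x ++ (runs after ++ R))
  runs-split {before = before} {x} {after} R refl = begin
    runs (before ++ x ∷ after) ++ R            ≡⟨ cong (_++ R) (concatMap-++ run before (x ∷ after)) ⟩
    (runs before ++ run x ++ runs after) ++ R  ≡⟨ ++-assoc (runs before) _ R ⟩
    runs before ++ (run x ++ runs after) ++ R  ≡⟨ cong (runs before ++_) (++-assoc (run x) (runs after) R) ⟩
    runs before ++ (run x ++ (runs after ++ R)) ∎
    where open ≡-Reasoning

  runs-++ : ∀ xs ys R → runs (xs ++ ys) ++ R ≡ runs xs ++ (runs ys ++ R)
  runs-++ xs ys R = trans (cong (_++ R) (concatMap-++ run xs ys)) (++-assoc (runs xs) (runs ys) R)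

  drop-runs : ∀ {xs before x after} k R → xs ≡ before ++ x ∷ after → k ≤ length (run x) →
              drop (length (runs before) + k) (runs xs ++ R) ≡ drop k (run x) ++ (runs after ++ R)
  drop-runs {xs} {before} {x} {after} k R split k≤x = begin
    drop (length (runs before) + k) (runs xs ++ R)                                ≡⟨ cong (drop (length (runs before) + k)) (runs-split R split) ⟩
    drop (length (runs before) + k) (runs before ++ (run x ++ (runs after ++ R))) ≡⟨ drop-++ʳ k (runs before) _ ⟩
    drop k (run x ++ (runs after ++ R))                                          ≡⟨ drop-++ˡ k (run x) _ k≤x ⟩
    drop k (run x) ++ (runs after ++ R)                                          ∎
    where open ≡-Reasoning

  length-runs-split : ∀ {xs before x after} → xs ≡ before ++ x ∷ after →
                      length (runs xs) ≡ length (runs before) + (length (run x) + length (runs after))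
  length-runs-split {before = before} {x} {after} refl =
    trans (cong length (concatMap-++ run before (x ∷ after))) (trans (length-++ (runs before)) (cong (length (runs before) +_) (length-++ (run x))))

  length-runs-++-[] : ∀ xs x → length (runs (xs ++ [ x ])) ≡ length (runs xs) + length (run x)
  length-runs-++-[] xs x = trans (cong length (concatMap-++ run xs [ x ]))
    (trans (length-++ (runs xs)) (cong (length (runs xs) +_) (cong length (++-identityʳ (run x)))))

  record Location (xs : List A) (s : ℕ) : Set where
    field
      before after : List A
      block        : A
      offset       : ℕ
      located      : xs ≡ before ++ block ∷ after
      inside       : offset < length (run block)
      position     : s ≡ length (runs before) + offset

    drop-at : ∀ R → drop s (runs xs ++ R) ≡ drop offset (run block) ++ (runs after ++ R)
    drop-at R rewrite position = drop-runs offset R located (<⇒≤ inside)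

  locate : ∀ xs {s} → s < length (runs xs) → Location xs s
  locate (x ∷ xs) {s} s<xs with s <? length (run x)
  ... | yes s<x = record { before = []; after = xs; block = x; offset = s; located = refl; inside = s<x; position = refl }
  ... | no s≮x = record
    { before = x ∷ L.before; after = L.after; block = L.block; offset = L.offset
    ; located = cong (x ∷_) L.located; inside = L.inside
    ; position = begin
        s                                                     ≡⟨ sym (m+[n∸m]≡n x≤s) ⟩
        length (run x) + s′                                   ≡⟨ cong (length (run x) +_) L.position ⟩
        length (run x) + (length (runs L.before) + L.offset)  ≡⟨ sym (+-assoc (length (run x)) _ L.offset) ⟩
        (length (run x) + length (runs L.before)) + L.offset  ≡⟨ cong (_+ L.offset) (sym (length-++ (run x))) ⟩
        length (runs (x ∷ L.before)) + L.offset               ∎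
    }
    where
      open ≡-Reasoning
      x≤s : length (run x) ≤ s
      x≤s = ≮⇒≥ s≮x
      s′ = s ∸ length (run x)
      s′<xs : s′ < length (runs xs)
      s′<xs = +-cancelˡ-< (length (run x)) s′ _
                (subst₂ _<_ (sym (m+[n∸m]≡n x≤s)) (length-++ (run x)) s<xs)
      module L = Location (locate xs s′<xs)

BreaksDesc : ℕ → List ℕ → Set
BreaksDesc b R = ∀ {v tl} → R ≡ v ∷ tl → suc v ≢ b

take-suc-desc : ∀ R {y e} → take (suc e) R ≡ desc y e → ∃ λ tl → R ≡ y + e ∷ tl
take-suc-desc [] {y} {e} eq with () ← trans eq (proj₂ (desc-head y e))
take-suc-desc (v ∷ R) {y} {e} eq = R , cong (_∷ R) (proj₁ (∷-injective (trans eq (proj₂ (desc-head y e)))))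

desc-infix : ∀ b d R {y e} → BreaksDesc b R → take (suc e) (desc b d ++ R) ≡ desc y e → b ≤ y × y + e ≤ b + d
desc-infix b zero R {e = zero} _ refl = ≤-refl , ≤-refl
desc-infix b zero R {y} {suc e} breaks eq with take-suc-desc R (proj₂ (∷-injective eq))
... | _ , refl = contradiction (sym (proj₁ (∷-injective eq))) (breaks refl)
desc-infix b (suc d) R {e = zero} _ refl = ≤-trans (m≤m+n b d) (n≤1+n _) , ≤-reflexive (trans (+-identityʳ _) (sym (+-suc b d)))
desc-infix b (suc d) R {y} {suc e} breaks eq with desc-infix b d R breaks (proj₂ (∷-injective eq))
... | b≤y , y+e≤b+d = b≤y , subst₂ _≤_ (sym (+-suc y e)) (sym (+-suc b d)) (s≤s y+e≤b+d)

desc-pair : ∀ b d R {u v tl} → desc b d ++ R ≡ u ∷ v ∷ tl → suc v ≢ u → d ≡ 0 × u ≡ b × R ≡ v ∷ tl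
desc-pair b zero R refl _ = refl , refl , refl
desc-pair b (suc d) R {u} {v} eq v+1≢u with desc-head b d
... | tl , head≡ = contradiction (trans (cong suc v≡) u≡) v+1≢u
  where
    u≡ : suc (b + d) ≡ u
    u≡ = proj₁ (∷-injective eq)
    v≡ : v ≡ b + d
    v≡ = proj₁ (∷-injective (trans (sym (proj₂ (∷-injective eq))) (cong (_++ R) head≡)))

asc-pair : ∀ b d R {u v tl} → asc b d ++ R ≡ u ∷ v ∷ tl → v ≢ suc u → d ≡ 0 × u ≡ b × R ≡ v ∷ tl
asc-pair b zero R refl _ = refl , refl , refl
asc-pair b (suc d) R {u} {v} eq v≢u+1 with asc-head (suc b) d
... | tl , head≡ = contradiction (trans (sym v≡) (cong suc u≡)) v≢u+1
  where
    u≡ : b ≡ u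
    u≡ = proj₁ (∷-injective eq)
    v≡ : suc b ≡ v
    v≡ = proj₁ (∷-injective (trans (sym (cong (_++ R) head≡)) (proj₂ (∷-injective eq))))

drop-desc-≤ : ∀ {k w} b → k ≤ w → drop k (desc b w) ≡ desc b (w ∸ k)
drop-desc-≤ {k} {w} b k≤w = trans (cong (drop k ∘ desc b) (sym (m+[n∸m]≡n k≤w))) (drop-desc k b (w ∸ k))

drop-asc-≤ : ∀ {k w} b → k ≤ w → drop k (asc b w) ≡ asc (k + b) (w ∸ k)
drop-asc-≤ {k} {w} b k≤w = trans (cong (drop k ∘ asc b) (sym (m+[n∸m]≡n k≤w))) (drop-asc k b (w ∸ k))

desc-run-pair : ∀ b w k R {u v tl} → k < length (desc b w) → drop k (desc b w) ++ R ≡ u ∷ v ∷ tl → suc v ≢ u →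
                suc k ≡ length (desc b w) × u ≡ b × R ≡ v ∷ tl
desc-run-pair b w k R {u} {v} {tl} k<len eq v+1≢u = conclude (desc-pair b (w ∸ k) R (trans (cong (_++ R) (sym (drop-desc-≤ b k≤w))) eq) v+1≢u)
  where
    k≤w = s≤s⁻¹ (subst (k <_) (length-desc b w) k<len)
    conclude : w ∸ k ≡ 0 × u ≡ b × R ≡ v ∷ tl → suc k ≡ length (desc b w) × u ≡ b × R ≡ v ∷ tl
    conclude (w∸k≡0 , u≡b , R≡) = trans (cong suc (≤-antisym k≤w (m∸n≡0⇒m≤n w∸k≡0))) (sym (length-desc b w)) , u≡b , R≡

asc-run-pair : ∀ b w k R {u v tl} → k < length (asc b w) → drop k (asc b w) ++ R ≡ u ∷ v ∷ tl → v ≢ suc u →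
               suc k ≡ length (asc b w) × u ≡ b + w × R ≡ v ∷ tl
asc-run-pair b w k R {u} {v} {tl} k<len eq v≢u+1 = conclude (asc-pair (k + b) (w ∸ k) R (trans (cong (_++ R) (sym (drop-asc-≤ b k≤w))) eq) v≢u+1)
  where
    k≤w = s≤s⁻¹ (subst (k <_) (length-asc b w) k<len)
    conclude : w ∸ k ≡ 0 × u ≡ k + b × R ≡ v ∷ tl → suc k ≡ length (asc b w) × u ≡ b + w × R ≡ v ∷ tl
    conclude (w∸k≡0 , u≡ , R≡) = trans (cong suc k≡w) (sym (length-asc b w)) , trans u≡ (trans (cong (_+ b) k≡w) (+-comm w b)) , R≡
      where k≡w = ≤-antisym k≤w (m∸n≡0⇒m≤n w∸k≡0)

desc-prefix : ∀ b e m → ∃ λ T → desc b (e + m) ≡ desc (b + m) e ++ T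
desc-prefix b e zero = [] , trans (cong (desc b) (+-identityʳ e)) (trans (cong (λ x → desc x e) (sym (+-identityʳ b))) (sym (++-identityʳ _)))
desc-prefix b e (suc m) = desc b m , desc-++ b e m

desc-window : ∀ {b w y e} → b ≤ y → y + e ≤ b + w → ∃ λ k → k + suc e ≤ suc w × ∃ λ T → drop k (desc b w) ≡ desc y e ++ T
desc-window {b} {w} {y} {e} b≤y y+e≤ = k , k+e<w , T , (begin
  drop k (desc b w)          ≡⟨ drop-desc-≤ b (m∸n≤m w (m + e)) ⟩
  desc b (w ∸ k)             ≡⟨ cong (desc b) (trans (m∸[m∸n]≡n m+e≤w) (+-comm m e)) ⟩
  desc b (e + m)             ≡⟨ proj₂ (desc-prefix b e m) ⟩
  desc (b + m) e ++ T        ≡⟨ cong (λ x → desc x e ++ T) (m+[n∸m]≡n b≤y) ⟩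
  desc y e ++ T              ∎)
  where
    open ≡-Reasoning
    m = y ∸ b
    k = w ∸ (m + e)
    T = proj₁ (desc-prefix b e m)
    m+e≤w : m + e ≤ w
    m+e≤w = +-cancelˡ-≤ b (m + e) w (subst (_≤ b + w) (trans (cong (_+ e) (sym (m+[n∸m]≡n b≤y))) (+-assoc b m e)) y+e≤)
    k+e<w : k + suc e ≤ suc w
    k+e<w = subst (_≤ suc w) (sym (+-suc k e)) (s≤s (subst (k + e ≤_) (m∸n+n≡m m+e≤w)
              (+-monoʳ-≤ k (m≤n+m e m))))

take-2⇒∷ : ∀ {A : Set} (zs : List A) {u v} → take 2 zs ≡ u ∷ v ∷ [] → ∃ λ tl → zs ≡ u ∷ v ∷ tl
take-2⇒∷ (_ ∷ _ ∷ zs) refl = zs , refl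

nonempty : ∀ {A : Set} {x : A} {xs} → x ∈ xs → ∃ λ y → ∃ λ ys → xs ≡ y ∷ ys
nonempty {xs = y ∷ ys} _ = y , ys , refl

∈-split : ∀ {A : Set} {xs : List A} {pre x post} → xs ≡ pre ++ x ∷ post → x ∈ xs
∈-split {pre = pre} split = subst (_ ∈_) (sym split) (∈-++⁺ʳ pre (here refl))

Consecutive-++ : ∀ {A : Set} {xs : List A} {x y} ys → Consecutive xs x y → Consecutive (xs ++ ys) x y
Consecutive-++ {xs = xs} ys (before , after , refl) = before , after ++ ys , ++-assoc before _ ys

reverse-split : ∀ {A : Set} {xs : List A} {before x after} → reverse xs ≡ before ++ x ∷ after → xs ≡ reverse after ++ x ∷ reverse before
reverse-split {xs = xs} {before} {x} {after} eq = begin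
  xs                                        ≡⟨ sym (reverse-involutive xs) ⟩
  reverse (reverse xs)                      ≡⟨ cong reverse eq ⟩
  reverse (before ++ x ∷ after)             ≡⟨ reverse-++ before (x ∷ after) ⟩
  reverse (x ∷ after) ++ reverse before     ≡⟨ cong (_++ reverse before) (unfold-reverse x after) ⟩
  (reverse after ++ [ x ]) ++ reverse before ≡⟨ ++-assoc (reverse after) [ x ] (reverse before) ⟩
  reverse after ++ x ∷ reverse before       ∎
  where open ≡-Reasoning

Consecutive-reverse : ∀ {A : Set} {xs : List A} {x y} → Consecutive (reverse xs) x y → Consecutive xs y x
Consecutive-reverse {xs = xs} {x} {y} (before , after , eq) = reverse after , reverse before ,
  trans (reverse-split {xs = xs} eq) (trans (cong (_++ x ∷ reverse before) (unfold-reverse y after)) (++-assoc (reverse after) [ y ] (x ∷ reverse before)))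

not-last⇒∈-init : ∀ {A : Set} (ys : List A) {x z w} before after → ys ++ [ x ] ≡ before ++ z ∷ w ∷ after → z ∈ ys
not-last⇒∈-init [] [] after ()
not-last⇒∈-init [] (_ ∷ []) after ()
not-last⇒∈-init [] (_ ∷ _ ∷ _) after ()
not-last⇒∈-init (y ∷ ys) [] after eq = here (proj₁ (∷-injective (sym eq)))
not-last⇒∈-init (y ∷ ys) (_ ∷ before) after eq = there (not-last⇒∈-init ys before after (proj₂ (∷-injective eq)))

-- Runs whose internal neighbours are Step-related, separated by junctions that are not.
module Junctions {A : Set} (run : A → List ℕ) (first last : A → ℕ) (Step : ℕ → ℕ → Set)
  (run-head : ∀ b R → ∃ λ tl → run b ++ R ≡ first b ∷ tl)
  (run-pair : ∀ b k R {u v tl} → k < length (run b) → drop k (run b) ++ R ≡ u ∷ v ∷ tl → ¬ Step u v →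
              suc k ≡ length (run b) × u ≡ last b × R ≡ v ∷ tl)
  where
  open Runs run

  -- A bigram that is not a Step only occurs across a junction, and its letters determine the junction.
  junction-first-occurrence :
    ∀ {xs l₁ x y l₂} R → xs ≡ l₁ ++ x ∷ y ∷ l₂ → x ∉ l₁ → ¬ Step (last x) (first y) →
    (∀ {z w} → Consecutive xs z w → last z ≡ last x → first w ≡ first y → z ≡ x) →
    ∀ {s} → suc s < length (runs l₁) + length (run x) →
    take 2 (drop s (runs xs ++ R)) ≢ last x ∷ first y ∷ []
  junction-first-occurrence {xs} {l₁} {x} {y} {l₂} R xs≡ x∉ ¬step same-junction {s} s+1<p eq =
    at (locate (l₁ ++ [ x ]) s<pre)
    where
      R′ = runs (y ∷ l₂) ++ R
      xs≡′ : xs ≡ (l₁ ++ [ x ]) ++ y ∷ l₂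
      xs≡′ = trans xs≡ (sym (++-assoc l₁ [ x ] (y ∷ l₂)))
      s<pre : s < length (runs (l₁ ++ [ x ]))
      s<pre = subst (s <_) (sym (length-runs-++-[] l₁ x)) (<-trans (n<1+n s) s+1<p)
      xs-runs : runs xs ++ R ≡ runs (l₁ ++ [ x ]) ++ R′
      xs-runs = trans (cong (λ zs → runs zs ++ R) xs≡′) (runs-++ (l₁ ++ [ x ]) (y ∷ l₂) R)
      at : Location (l₁ ++ [ x ]) s → ⊥
      at loc = followed-by after located (proj₂ (proj₂ pair))
        where
          open Location loc
          occurrence = take-2⇒∷ (drop s (runs xs ++ R)) eq
          pair = run-pair block offset (runs after ++ R′) inside
                   (trans (sym (drop-at R′)) (trans (cong (drop s) (sym xs-runs)) (proj₂ occurrence))) ¬step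
          followed-by : ∀ C → l₁ ++ [ x ] ≡ before ++ block ∷ C → runs C ++ R′ ≡ first y ∷ proj₁ occurrence → ⊥
          followed-by [] split′ _ with ∷ʳ-injective l₁ before split′
          ... | refl , refl = <-irrefl refl (subst (_< length (runs l₁) + length (run x)) s+1≡ s+1<p)
            where
              s+1≡ : suc s ≡ length (runs l₁) + length (run x)
              s+1≡ = trans (cong suc position) (trans (sym (+-suc _ offset)) (cong (length (runs l₁) +_) (proj₁ pair)))
          followed-by (w ∷ C) split′ rest≡ =
            x∉ (subst (_∈ l₁) block≡x (not-last⇒∈-init l₁ before C split′))
            where
              first≡ : first w ≡ first y
              first≡ = proj₁ (∷-injective (trans (sym (proj₂ (run-head w (runs C ++ R′)))) (trans (sym (++-assoc (run w) (runs C) R′)) rest≡)))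
              block≡x : block ≡ x
              block≡x = same-junction (subst (λ zs → Consecutive zs block w) (sym xs≡′) (Consecutive-++ (y ∷ l₂) (before , C , split′)))
                          (sym (proj₁ (proj₂ pair))) first≡

module _ {A : Set} {R : Rel A 0ℓ} where

  AllPairs-before : ∀ pre {x} post {y} → AllPairs R (pre ++ x ∷ post) → y ∈ pre → R y x
  AllPairs-before (z ∷ pre) post (z<all ∷ _) (here refl) = All.lookup z<all (∈-++⁺ʳ pre (here refl))
  AllPairs-before (z ∷ pre) post (_ ∷ sorted) (there y∈pre) = AllPairs-before pre post sorted y∈pre

  AllPairs-after : ∀ pre {x} post {y} → AllPairs R (pre ++ x ∷ post) → y ∈ post → R x y
  AllPairs-after [] post (x<all ∷ _) y∈post = All.lookup x<all y∈post
  AllPairs-after (z ∷ pre) post (_ ∷ sorted) y∈post = AllPairs-after pre post sorted y∈post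

module SortedEnumeration {A : Set} {_≺_ : Rel A 0ℓ} (≺-irrefl : ∀ {x} → ¬ x ≺ x) (≺-trans : Transitive _≺_)
  (V : A → Set) (xs : List A) (sorted : AllPairs _≺_ xs) (complete : ∀ {x} → V x → x ∈ xs) where

  ≺-asym : ∀ {x y} → x ≺ y → ¬ y ≺ x
  ≺-asym x≺y y≺x = ≺-irrefl (≺-trans x≺y y≺x)

  ∈before⇒≺ : ∀ {pre x post y} → xs ≡ pre ++ x ∷ post → y ∈ pre → y ≺ x
  ∈before⇒≺ {pre} {post = post} split = AllPairs-before pre post (subst (AllPairs _≺_) split sorted)

  ∈after⇒≻ : ∀ {pre x post y} → xs ≡ pre ++ x ∷ post → y ∈ post → x ≺ y
  ∈after⇒≻ {pre} {post = post} split = AllPairs-after pre post (subst (AllPairs _≺_) split sorted)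

  ≺⇒∈before : ∀ {pre x post y} → xs ≡ pre ++ x ∷ post → V y → y ≺ x → y ∈ pre
  ≺⇒∈before {pre} {x} {post} {y} split vy y≺x with ∈-++⁻ pre (subst (y ∈_) split (complete vy))
  ... | inj₁ y∈pre = y∈pre
  ... | inj₂ (here refl) = contradiction y≺x ≺-irrefl
  ... | inj₂ (there y∈post) = contradiction (∈after⇒≻ split y∈post) (≺-asym y≺x)

  consecutive⇒≺ : ∀ {x y} → Consecutive xs x y → x ≺ y
  consecutive⇒≺ (pre , post , split) = ∈after⇒≻ {pre} split (here refl)

  consecutive-adjacent : ∀ {x y z} → Consecutive xs x y → V z → x ≺ z → ¬ z ≺ y
  consecutive-adjacent {x} {y} {z} (pre , post , split) vz x≺z z≺y =
    case ∈-++⁻ pre (≺⇒∈before (trans split (sym (++-assoc pre [ x ] (y ∷ post)))) vz z≺y) of λ where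
      (inj₁ z∈pre) → ≺-asym x≺z (∈before⇒≺ split z∈pre)
      (inj₂ (here refl)) → ≺-irrefl x≺z

Block : Set
Block = ℕ × ℕ

radius centre width low high : Block → ℕ
radius = proj₁
centre = proj₂
width b = radius b + radius b
low b = centre b ∸ radius b
high b = low b + width b

_⊏_ : Rel Block 0ℓ
_⊏_ = ×-Lex _≡_ _<_ _<_

⊏-trans : ∀ {x y z} → x ⊏ y → y ⊏ z → x ⊏ z
⊏-trans = ×-transitive {_≈₁_ = _≡_} {_<₁_ = _<_} {_<₂_ = _<_} isEquivalence (resp₂ _<_) <-trans <-trans

⊏-irrefl : ∀ {x} → ¬ x ⊏ x
⊏-irrefl = ×-irreflexive {_≈₁_ = _≡_} {_<₁_ = _<_} {_≈₂_ = _≡_} {_<₂_ = _<_} <-irrefl <-irrefl (refl , refl)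

⊏⇒radius≤ : ∀ {x y} → x ⊏ y → radius x ≤ radius y
⊏⇒radius≤ (inj₁ r<r′) = <⇒≤ r<r′
⊏⇒radius≤ (inj₂ (refl , _)) = ≤-refl

⊏-compare : ∀ x y → x ⊏ y ⊎ x ≡ y ⊎ y ⊏ x
⊏-compare x y with ×-compare sym <-cmp <-cmp x y
... | tri< x⊏y _ _ = inj₁ x⊏y
... | tri≈ _ x≋y _ = inj₂ (inj₁ (≡×≡⇒≡ x≋y))
... | tri> _ _ y⊏x = inj₂ (inj₂ y⊏x)

⊏-same-radius : ∀ {x y} → x ⊏ y → radius x ≡ radius y → centre x < centre y
⊏-same-radius (inj₁ rx<ry) rx≡ry = contradiction rx≡ry (<⇒≢ rx<ry)
⊏-same-radius (inj₂ (_ , cx<cy)) _ = cx<cy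

1≤2^ : ∀ i → 1 ≤ 2 ^ i
1≤2^ i = m^n>0 2 i

2^suc : ∀ i → 2 ^ suc i ≡ 2 ^ i + 2 ^ i
2^suc i = cong (2 ^ i +_) (+-identityʳ (2 ^ i))

length-concatMap-const : ∀ {A B : Set} (f : A → List B) {k} → (∀ x → length (f x) ≡ k) →
                         ∀ xs → length (concatMap f xs) ≡ length xs * k
length-concatMap-const f f≡k [] = refl
length-concatMap-const f f≡k (x ∷ xs) =
  trans (length-++ (f x)) (cong₂ _+_ (f≡k x) (length-concatMap-const f f≡k xs))

AllPairs-concatMap-upTo : ∀ {A : Set} {R : Rel A 0ℓ} (f : ℕ → List A) m → (∀ j → AllPairs R (f j)) →
  (∀ {j j′} → j < j′ → ∀ {x y} → x ∈ f j → y ∈ f j′ → R x y) → AllPairs R (concatMap f (upTo m))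
AllPairs-concatMap-upTo f m within across = AllPairs.concat⁺ (All.map⁺ (All.tabulate λ {j} _ → within j))
  (AllPairs.map⁺ (AllPairs.applyUpTo⁺₁ (λ j → j) m λ j<j′ _ →
    All.tabulate λ x∈ → All.tabulate λ y∈ → across j<j′ x∈ y∈))

multiples-close⇒≡ : ∀ {d a b} → d ∣ a → d ∣ b → a ≤ b → b < a + d → a ≡ b
multiples-close⇒≡ {d} {a} {b} d∣a d∣b a≤b b<a+d with b ∸ a in b∸a≡
... | zero = ≤-antisym a≤b (m∸n≡0⇒m≤n b∸a≡)
... | suc k = contradiction d∣b∸a (>⇒∤ k<d)
  where
    d∣b∸a : d ∣ suc k
    d∣b∸a = subst (d ∣_) b∸a≡ (∣m+n∣m⇒∣n (subst (d ∣_) (sym (m+[n∸m]≡n a≤b)) d∣b) d∣a)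
    k<d : suc k < d
    k<d = subst (_< d) b∸a≡ (+-cancelˡ-< a (b ∸ a) d (subst (_< a + d) (sym (m+[n∸m]≡n a≤b)) b<a+d))

∸-pred : ∀ {m k} → suc k ≤ m → m ∸ k ≡ suc (m ∸ suc k)
∸-pred {suc m} {k} (s≤s k≤m) = +-∸-assoc 1 k≤m

[m+n]∸[m∸1]≡1+n : ∀ {m n} → 1 ≤ m → (m + n) ∸ (m ∸ 1) ≡ suc n
[m+n]∸[m∸1]≡1+n {suc m} {n} _ = trans (cong (_∸ m) (sym (+-suc m n))) (m+n∸m≡n m (suc n))

<m+m⇒≤m+[m∸1] : ∀ {m r} → 1 ≤ m → r < m + m → r ≤ m + (m ∸ 1)
<m+m⇒≤m+[m∸1] {m} {r} 1≤m r<2m = subst (r ≤_) (+-∸-assoc m 1≤m) (m+n≤o⇒m≤o∸n r (subst (_≤ m + m) (+-comm 1 r) r<2m))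

junction-gap : ∀ {S r h c} → r < S → h ≤ (S + S) + suc r → 8 * S ≤ c + S → suc (suc h) + r ≤ c
junction-gap {S} {r} {h} {c} r<S h≤ 8S≤ = begin
  suc (suc h) + r                        ≤⟨ +-monoˡ-≤ r (s≤s (s≤s h≤)) ⟩
  suc (suc ((S + S) + suc r)) + r
    ≡⟨ solve 2 (λ s r → (con 2 :+ ((s :+ s) :+ (con 1 :+ r))) :+ r := (s :+ s) :+ ((con 1 :+ r) :+ (con 1 :+ r)) :+ con 1) refl S r ⟩
  (S + S) + (suc r + suc r) + 1          ≤⟨ +-mono-≤ (+-monoʳ-≤ (S + S) (+-mono-≤ r<S r<S)) (≤-trans (s≤s z≤n) r<S) ⟩
  (S + S) + (S + S) + S                  ≡⟨ solve 1 (λ s → (s :+ s) :+ (s :+ s) :+ s := con 5 :* s) refl S ⟩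
  5 * S                                  ≤⟨ *-monoˡ-≤ S (m≤m+n 5 2) ⟩
  7 * S                                  ≤⟨ +-cancelʳ-≤ S (7 * S) c (subst (_≤ c + S) (solve 1 (λ s → con 8 :* s := con 7 :* s :+ s) refl S) 8S≤) ⟩
  c                                      ∎
  where
    open ≤-Reasoning
    open +-*-Solver

module Family (n : ℕ) where

  N : ℕ
  N = 2 ^ (3 + n)

  spacing : ℕ → ℕ
  spacing i = 2 ^ suc i

  cells : ℕ → ℕ
  cells i = 2 ^ ((2 + n) ∸ i)

  blockAt : ℕ → ℕ → ℕ → Block
  blockAt i t a = (2 ^ i + t , suc a * spacing i)

  blocksOfRadius : ℕ → ℕ → List Block
  blocksOfRadius i t = map (blockAt i t) (upTo (cells i ∸ 1))

  blocksOfPhase : ℕ → List Block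
  blocksOfPhase i = concatMap (blocksOfRadius i) (upTo (2 ^ i))

  blocks : List Block
  blocks = concatMap blocksOfPhase (upTo n)

  2^i*cells : ∀ {i} → i ≤ 2 + n → 2 ^ i * cells i ≡ 2 ^ (2 + n)
  2^i*cells {i} i≤ = trans (sym (^-distribˡ-+-* 2 i ((2 + n) ∸ i))) (cong (2 ^_) (m+[n∸m]≡n i≤))

  cells*spacing : ∀ {i} → i ≤ 2 + n → cells i * spacing i ≡ N
  cells*spacing {i} i≤ = trans (sym (^-distribˡ-+-* 2 ((2 + n) ∸ i) (suc i)))
    (cong (2 ^_) (trans (+-suc ((2 + n) ∸ i) i) (cong suc (m∸n+n≡m i≤))))

  cells-1>0 : ∀ {i} → i < n → 0 < cells i ∸ 1
  cells-1>0 {i} i<n = m<n⇒0<n∸m (^-monoʳ-< 2 ≤-refl (m<n⇒0<n∸m (≤-trans i<n (m≤n+m n 2))))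

  record Valid (b : Block) : Set where
    constructor valid
    field
      phase offset slot : ℕ
      phase<n  : phase < n
      offset<  : offset < 2 ^ phase
      slot<    : slot < cells phase ∸ 1
      ≡block   : b ≡ blockAt phase offset slot

    radius≡ : radius b ≡ 2 ^ phase + offset
    radius≡ = cong radius ≡block

    centre≡ : centre b ≡ suc slot * spacing phase
    centre≡ = cong centre ≡block

    2^phase≤radius : 2 ^ phase ≤ radius b
    2^phase≤radius = subst (2 ^ phase ≤_) (sym radius≡) (m≤m+n _ _)

    1≤radius : 1 ≤ radius b
    1≤radius = ≤-trans (1≤2^ phase) 2^phase≤radius

    radius<spacing : radius b < spacing phase
    radius<spacing = subst₂ _<_ (sym radius≡) (sym (2^suc phase)) (+-monoʳ-< (2 ^ phase) offset<)

    spacing≤centre : spacing phase ≤ centre b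
    spacing≤centre = subst (spacing phase ≤_) (sym centre≡) (m≤m+n (spacing phase) _)

    radius≤centre : radius b ≤ centre b
    radius≤centre = ≤-trans (<⇒≤ radius<spacing) spacing≤centre

    spacing∣centre : spacing phase ∣ centre b
    spacing∣centre = subst (spacing phase ∣_) (sym centre≡) (n∣m*n (suc slot))

    spacing≤2^n : spacing phase ≤ 2 ^ n
    spacing≤2^n = ^-monoʳ-≤ 2 phase<n

    centre+spacing≤N : centre b + spacing phase ≤ N
    centre+spacing≤N = begin
      centre b + spacing phase              ≡⟨ cong (_+ spacing phase) centre≡ ⟩
      suc slot * spacing phase + spacing phase ≡⟨ +-comm (suc slot * spacing phase) (spacing phase) ⟩
      suc (suc slot) * spacing phase        ≤⟨ *-monoˡ-≤ (spacing phase) slot+2≤cells ⟩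
      cells phase * spacing phase           ≡⟨ cells*spacing (≤-trans (<⇒≤ phase<n) (m≤n+m n 2)) ⟩
      N                                     ∎
      where
        open ≤-Reasoning
        slot+2≤cells : suc (suc slot) ≤ cells phase
        slot+2≤cells = subst (suc (suc slot) ≤_) (m∸n+n≡m (1≤2^ ((2 + n) ∸ phase)))
          (subst (_≤ cells phase ∸ 1 + 1) (+-comm (suc slot) 1) (+-monoˡ-≤ 1 slot<))

    low+radius≡centre : low b + radius b ≡ centre b
    low+radius≡centre = m∸n+n≡m radius≤centre

    high≡centre+radius : high b ≡ centre b + radius b
    high≡centre+radius = trans (sym (+-assoc (low b) (radius b) (radius b))) (cong (_+ radius b) low+radius≡centre)

    high<N : high b < N
    high<N = subst (_< N) (sym high≡centre+radius) (<-≤-trans (+-monoʳ-< (centre b) radius<spacing) centre+spacing≤N)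

  ∈-blocks⇒Valid : ∀ {b} → b ∈ blocks → Valid b
  ∈-blocks⇒Valid b∈ =
    let (i , i∈ , b∈phase) = find (∈-concatMap⁻ blocksOfPhase {xs = upTo n} b∈)
        (t , t∈ , b∈radius) = find (∈-concatMap⁻ (blocksOfRadius i) {xs = upTo (2 ^ i)} b∈phase)
        (a , a∈ , b≡) = ∈-map⁻ (blockAt i t) b∈radius
    in valid i t a (∈-upTo⁻ i∈) (∈-upTo⁻ t∈) (∈-upTo⁻ a∈) b≡

  Valid⇒∈-blocks : ∀ {b} → Valid b → b ∈ blocks
  Valid⇒∈-blocks (valid i t a i<n t< a< refl) =
    ∈-concatMap⁺ blocksOfPhase (lose (∈-upTo⁺ i<n)
      (∈-concatMap⁺ (blocksOfRadius i) (lose (∈-upTo⁺ t<) (∈-map⁺ (blockAt i t) (∈-upTo⁺ a<)))))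

  radius-∈-blocksOfRadius : ∀ {i t b} → b ∈ blocksOfRadius i t → radius b ≡ 2 ^ i + t
  radius-∈-blocksOfRadius {i} {t} b∈ with ∈-map⁻ (blockAt i t) b∈
  ... | _ , _ , refl = refl

  radius-∈-blocksOfPhase : ∀ {i b} → b ∈ blocksOfPhase i → 2 ^ i ≤ radius b × radius b < 2 ^ suc i
  radius-∈-blocksOfPhase {i} b∈ with find (∈-concatMap⁻ (blocksOfRadius i) {xs = upTo (2 ^ i)} b∈)
  ... | t , t∈ , b∈radius rewrite radius-∈-blocksOfRadius {i} {t} b∈radius =
    m≤m+n (2 ^ i) t , subst (2 ^ i + t <_) (sym (2^suc i)) (+-monoʳ-< (2 ^ i) (∈-upTo⁻ t∈))

  blocks-sorted : AllPairs _⊏_ blocks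
  blocks-sorted = AllPairs-concatMap-upTo blocksOfPhase n
    (λ i → AllPairs-concatMap-upTo (blocksOfRadius i) (2 ^ i)
      (λ t → AllPairs.map⁺ (AllPairs.applyUpTo⁺₁ (λ a → a) (cells i ∸ 1)
        λ a<a′ _ → inj₂ (refl , *-monoˡ-< (spacing i) {{>-nonZero (1≤2^ (suc i))}} (s≤s a<a′))))
      λ {t} {t′} t<t′ x∈ y∈ → inj₁ (subst₂ _<_ (sym (radius-∈-blocksOfRadius {i} {t} x∈))
        (sym (radius-∈-blocksOfRadius {i} {t′} y∈)) (+-monoʳ-< (2 ^ i) t<t′)))
    λ {i} {i′} i<i′ x∈ y∈ → inj₁ (<-≤-trans (proj₂ (radius-∈-blocksOfPhase {i} x∈))
      (≤-trans (^-monoʳ-≤ 2 i<i′) (proj₁ (radius-∈-blocksOfPhase {i′} y∈))))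

  length-blocksOfPhase : ∀ {i} → i ≤ 2 + n → length (blocksOfPhase i) + 2 ^ i ≡ 2 ^ (2 + n)
  length-blocksOfPhase {i} i≤ = begin
    length (blocksOfPhase i) + 2 ^ i            ≡⟨ cong (_+ 2 ^ i) (length-concatMap-const (blocksOfRadius i) length-blocksOfRadius (upTo (2 ^ i))) ⟩
    length (upTo (2 ^ i)) * (cells i ∸ 1) + 2 ^ i ≡⟨ cong₂ (λ k l → k * (cells i ∸ 1) + l) (length-upTo (2 ^ i)) (sym (*-identityʳ (2 ^ i))) ⟩
    2 ^ i * (cells i ∸ 1) + 2 ^ i * 1            ≡⟨ sym (*-distribˡ-+ (2 ^ i) (cells i ∸ 1) 1) ⟩
    2 ^ i * (cells i ∸ 1 + 1)                    ≡⟨ cong (2 ^ i *_) (m∸n+n≡m (1≤2^ ((2 + n) ∸ i))) ⟩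
    2 ^ i * cells i                              ≡⟨ 2^i*cells i≤ ⟩
    2 ^ (2 + n)                                  ∎
    where
      open ≡-Reasoning
      length-blocksOfRadius : ∀ t → length (blocksOfRadius i t) ≡ cells i ∸ 1
      length-blocksOfRadius t = trans (length-map (blockAt i t) (upTo (cells i ∸ 1))) (length-upTo (cells i ∸ 1))

  length-blocks : length blocks + 2 ^ n ≡ n * 2 ^ (2 + n) + 1
  length-blocks = first-phases n ≤-refl
    where
      open ≡-Reasoning
      open +-*-Solver
      first-phases : ∀ m → m ≤ n → length (concatMap blocksOfPhase (upTo m)) + 2 ^ m ≡ m * 2 ^ (2 + n) + 1
      first-phases zero _ = refl
      first-phases (suc m) m<n = begin
        length (concatMap blocksOfPhase (upTo (suc m))) + 2 ^ suc m
          ≡⟨ cong (λ is → length (concatMap blocksOfPhase is) + 2 ^ suc m) (sym (upTo-∷ʳ m)) ⟩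
        length (concatMap blocksOfPhase (upTo m ++ [ m ])) + 2 ^ suc m
          ≡⟨ cong (λ xs → length xs + 2 ^ suc m) (concatMap-++ blocksOfPhase (upTo m) [ m ]) ⟩
        length (concatMap blocksOfPhase (upTo m) ++ blocksOfPhase m ++ []) + 2 ^ suc m
          ≡⟨ cong (_+ 2 ^ suc m) (trans (length-++ (concatMap blocksOfPhase (upTo m)))
               (cong (length (concatMap blocksOfPhase (upTo m)) +_) (cong length (++-identityʳ (blocksOfPhase m))))) ⟩
        (length (concatMap blocksOfPhase (upTo m)) + length (blocksOfPhase m)) + 2 ^ suc m
          ≡⟨ solve 3 (λ x y p → (x :+ y) :+ (p :+ (p :+ con 0)) := (x :+ p) :+ (y :+ p)) refl
               (length (concatMap blocksOfPhase (upTo m))) (length (blocksOfPhase m)) (2 ^ m) ⟩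
        (length (concatMap blocksOfPhase (upTo m)) + 2 ^ m) + (length (blocksOfPhase m) + 2 ^ m)
          ≡⟨ cong₂ _+_ (first-phases m (<⇒≤ m<n)) (length-blocksOfPhase (≤-trans (<⇒≤ m<n) (m≤n+m n 2))) ⟩
        (m * 2 ^ (2 + n) + 1) + 2 ^ (2 + n)
          ≡⟨ solve 2 (λ m q → (m :* q :+ con 1) :+ q := (con 1 :+ m) :* q :+ con 1) refl m (2 ^ (2 + n)) ⟩
        suc m * 2 ^ (2 + n) + 1 ∎

  phase-mono : ∀ {x y} (vx : Valid x) (vy : Valid y) → radius x ≤ radius y → Valid.phase vx ≤ Valid.phase vy
  phase-mono vx vy rx≤ry with Valid.phase vx ≤? Valid.phase vy
  ... | yes ix≤iy = ix≤iy
  ... | no ix≰iy = contradiction rx≤ry (<⇒≱ (<-≤-trans (Valid.radius<spacing vy)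
          (≤-trans (^-monoʳ-≤ 2 (≰⇒> ix≰iy)) (Valid.2^phase≤radius vx))))

  spacing-mono : ∀ {x y} (vx : Valid x) (vy : Valid y) → radius x ≤ radius y → spacing (Valid.phase vx) ≤ spacing (Valid.phase vy)
  spacing-mono vx vy rx≤ry = ^-monoʳ-≤ 2 (s≤s (phase-mono vx vy rx≤ry))

  spacing∣centre-of-larger : ∀ {x y} (vx : Valid x) (vy : Valid y) → radius x ≤ radius y → spacing (Valid.phase vx) ∣ centre y
  spacing∣centre-of-larger vx vy rx≤ry = ∣-trans (2^[1+i]∣2^[1+j] (phase-mono vx vy rx≤ry)) (Valid.spacing∣centre vy)
    where
      2^[1+i]∣2^[1+j] : ∀ {i j} → i ≤ j → 2 ^ suc i ∣ 2 ^ suc j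
      2^[1+i]∣2^[1+j] {i} {j} i≤j = subst (2 ^ suc i ∣_)
        (trans (sym (^-distribˡ-+-* 2 (suc i) (j ∸ i))) (cong (λ k → 2 ^ suc k) (m+[n∸m]≡n i≤j))) (m∣m*n _)


  -- Blocks of phase ≤ i contain at most one multiple of spacing i: their own centre.
  earlier-covering-centre : ∀ {x b} → Valid x → Valid b → x ⊏ b → low x ≤ centre b → centre b ≤ high x →
                            centre x ≡ centre b × radius x < radius b
  earlier-covering-centre {x} {b} vx vb x⊏b low≤c c≤high = cx≡cb , radius< x⊏b
    where
      d = spacing (Valid.phase vx)
      d∣cx = Valid.spacing∣centre vx
      d∣cb = spacing∣centre-of-larger vx vb (⊏⇒radius≤ x⊏b)
      rx<d = Valid.radius<spacing vx
      cx≡cb : centre x ≡ centre b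
      cx≡cb with ≤-total (centre x) (centre b)
      ... | inj₁ cx≤cb = multiples-close⇒≡ d∣cx d∣cb cx≤cb
            (≤-<-trans (subst (centre b ≤_) (Valid.high≡centre+radius vx) c≤high) (+-monoʳ-< (centre x) rx<d))
      ... | inj₂ cb≤cx = sym (multiples-close⇒≡ d∣cb d∣cx cb≤cx
            (≤-<-trans (subst (_≤ centre b + radius x) (Valid.low+radius≡centre vx) (+-monoˡ-≤ (radius x) low≤c))
              (+-monoʳ-< (centre b) rx<d)))
      radius< : x ⊏ b → radius x < radius b
      radius< (inj₁ rx<rb) = rx<rb
      radius< (inj₂ (_ , cx<cb)) = contradiction cx≡cb (<⇒≢ cx<cb)

  record EarlierCover (b : Block) (y e : ℕ) : Set where
    constructor cover
    field
      {source}  : Block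
      validSource : Valid source
      earlier     : source ⊏ b
      low≤        : low source ≤ y
      ≤high       : y + e ≤ high source

  upper-half-uncovered : ∀ {b} → Valid b → ¬ EarlierCover b (centre b) (radius b)
  upper-half-uncovered {b} vb (cover {x} vx x⊏b low≤c c+r≤high) =
    <-irrefl refl (<-≤-trans (+-monoʳ-< (centre b) rx<rb) (subst (centre b + radius b ≤_) high-x≡ c+r≤high))
    where
      covering = earlier-covering-centre vx vb x⊏b low≤c (≤-trans (m≤m+n (centre b) (radius b)) c+r≤high)
      rx<rb = proj₂ covering
      high-x≡ : high x ≡ centre b + radius x
      high-x≡ = trans (Valid.high≡centre+radius vx) (cong (_+ radius x) (proj₁ covering))

  lower-half-uncovered : ∀ {b} → Valid b → ¬ EarlierCover b (low b) (radius b)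
  lower-half-uncovered {b} vb (cover {x} vx x⊏b low≤low l+r≤high) =
    <⇒≱ (subst (low b <_) (cong (_∸ radius x) (sym (proj₁ covering))) (∸-monoʳ-< (proj₂ covering) (Valid.radius≤centre vb))) low≤low
    where
      covering = earlier-covering-centre vx vb x⊏b (≤-trans low≤low (m∸n≤m (centre b) (radius b)))
                   (subst (_≤ high x) (Valid.low+radius≡centre vb) l+r≤high)

  private
    cells-suc : ∀ {j} → suc j ≤ 2 + n → cells j ≡ 2 * cells (suc j)
    cells-suc {j} j<2+n = cong (2 ^_) (+-∸-assoc 1 j<2+n)

    slot-double : ∀ {j a} → suc j ≤ 2 + n → a < cells (suc j) ∸ 1 → suc (a + suc a) < cells j ∸ 1
    slot-double {j} {a} j<2+n a< = subst (suc (a + suc a) <_) (cong (_∸ 1) (sym (cells-suc j<2+n)))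
      (m+n≤o⇒m≤o∸n (suc (suc (a + suc a))) (subst (_≤ 2 * m) (solve 1 (λ a → (con 2 :+ a) :+ (con 2 :+ a) := (con 2 :+ (a :+ (con 1 :+ a))) :+ con 1) refl a)
        (+-mono-≤ a+2≤m (subst (suc (suc a) ≤_) (sym (+-identityʳ m)) a+2≤m))))
      where
        open +-*-Solver
        m = cells (suc j)
        a+2≤m : suc (suc a) ≤ m
        a+2≤m = subst (suc (suc a) ≤_) (m∸n+n≡m (1≤2^ ((2 + n) ∸ suc j))) (subst (_≤ (m ∸ 1) + 1) (+-comm (suc a) 1) (+-monoˡ-≤ 1 a<))

    centre-double : ∀ j a → suc a * spacing (suc j) ≡ suc (a + suc a) * spacing j
    centre-double j a = solve 2 (λ a x → (con 1 :+ a) :* (con 2 :* x) := (con 1 :+ (a :+ (con 1 :+ a))) :* x) refl a (spacing j)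
      where open +-*-Solver

    spacing-pred : ∀ j → 2 ^ j + (2 ^ j ∸ 1) ≡ spacing j ∸ 1
    spacing-pred j = trans (sym (+-∸-assoc (2 ^ j) (1≤2^ j))) (cong (_∸ 1) (sym (2^suc j)))

  Valid-smaller-radius : ∀ {b r′} → Valid b → radius b ≡ suc r′ → 1 ≤ r′ → Valid (r′ , centre b)
  Valid-smaller-radius (valid i (suc t) a i<n t< a< refl) r≡ _ =
    valid i t a i<n (<-trans (n<1+n t) t<) a< (cong (_, _) (trans (sym (cong pred r≡)) (cong pred (+-suc (2 ^ i) t))))
  Valid-smaller-radius (valid zero zero a _ _ _ refl) r≡ 1≤r′ = contradiction (sym (cong pred r≡)) (≢-sym (<⇒≢ 1≤r′))
  Valid-smaller-radius (valid (suc j) zero a i<n _ a< refl) r≡ _ =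
    valid j (2 ^ j ∸ 1) (a + suc a) (<-trans (n<1+n j) i<n) (∸-monoʳ-< {2 ^ j} {1} {0} z<s (1≤2^ j))
      (<-trans (n<1+n _) (slot-double (≤-trans (<⇒≤ i<n) (m≤n+m n 2)) a<))
      (cong₂ _,_ (trans (sym (cong pred r≡)) (trans (cong pred (+-identityʳ (2 ^ suc j))) (sym (spacing-pred j)))) (centre-double j a))

  lower-cover : ∀ {b r′} → Valid b → radius b ≡ suc r′ → 1 ≤ r′ → EarlierCover b (suc (low b)) r′
  lower-cover {b} {r′} vb r≡ 1≤r′ = cover vx (inj₁ (subst (r′ <_) (sym r≡) ≤-refl)) (≤-reflexive low≡) high≥
    where
      open Valid vb
      vx = Valid-smaller-radius vb r≡ 1≤r′
      low≡ : low (r′ , centre b) ≡ suc (low b)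
      low≡ = trans (∸-pred (subst (_≤ centre b) r≡ radius≤centre)) (cong (λ r → suc (centre b ∸ r)) (sym r≡))
      high≥ : suc (low b) + r′ ≤ high (r′ , centre b)
      high≥ = begin
        suc (low b) + r′       ≡⟨ sym (+-suc (low b) r′) ⟩
        low b + suc r′         ≡⟨ cong (low b +_) (sym r≡) ⟩
        low b + radius b       ≡⟨ low+radius≡centre ⟩
        centre b               ≤⟨ m≤m+n (centre b) r′ ⟩
        centre b + r′          ≡⟨ sym (Valid.high≡centre+radius vx) ⟩
        high (r′ , centre b)   ∎
        where open ≤-Reasoning

  upper-cover : ∀ {b r′} → Valid b → radius b ≡ suc r′ → 1 ≤ r′ → EarlierCover b (suc (centre b)) r′
  upper-cover (valid zero zero a _ _ _ refl) r≡ 1≤r′ = contradiction (sym (cong pred r≡)) (≢-sym (<⇒≢ 1≤r′))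
  upper-cover (valid zero (suc t) a _ (s≤s ()) _ refl) _ _
  upper-cover {b} {r′} vb@(valid (suc j) t a i<n t< a< refl) r≡ _ =
    cover vx (inj₁ radius-x<r) (≤-reflexive low≡) high≥
    where
      open Valid vb using (2^phase≤radius; radius<spacing)
      S = spacing j
      c = centre b
      x = blockAt j (2 ^ j ∸ 1) (suc (a + suc a))
      vx : Valid x
      vx = valid j (2 ^ j ∸ 1) (suc (a + suc a)) (<-trans (n<1+n j) i<n) (∸-monoʳ-< {2 ^ j} {1} {0} z<s (1≤2^ j))
             (slot-double (≤-trans (<⇒≤ i<n) (m≤n+m n 2)) a<) refl
      1≤S = 1≤2^ (suc j)
      radius-x≡ : radius x ≡ S ∸ 1
      radius-x≡ = spacing-pred j
      centre-x≡ : centre x ≡ S + c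
      centre-x≡ = cong (S +_) (sym (centre-double j a))
      radius-x<r : radius x < radius b
      radius-x<r = subst (_< radius b) (sym radius-x≡) (<-≤-trans (∸-monoʳ-< {S} {1} {0} z<s 1≤S) 2^phase≤radius)
      low≡ : low x ≡ suc c
      low≡ = trans (cong₂ _∸_ centre-x≡ radius-x≡) ([m+n]∸[m∸1]≡1+n 1≤S)
      high≥ : suc c + r′ ≤ high x
      high≥ = begin
        suc c + r′              ≡⟨ sym (+-suc c r′) ⟩
        c + suc r′              ≡⟨ cong (c +_) (sym r≡) ⟩
        c + radius b            ≤⟨ +-monoʳ-≤ c (<m+m⇒≤m+[m∸1] 1≤S (subst (radius b <_) (2^suc (suc j)) radius<spacing)) ⟩
        c + (S + (S ∸ 1))       ≡⟨ solve 3 (λ c s s′ → c :+ (s :+ s′) := (s :+ c) :+ s′) refl c S (S ∸ 1) ⟩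
        (S + c) + (S ∸ 1)       ≡⟨ sym (trans (Valid.high≡centre+radius vx) (cong₂ _+_ centre-x≡ radius-x≡)) ⟩
        high x                  ∎
        where
          open ≤-Reasoning
          open +-*-Solver

  open SortedEnumeration ⊏-irrefl ⊏-trans Valid blocks blocks-sorted Valid⇒∈-blocks public

  Consecutive⇒Valid : ∀ {x y} → Consecutive blocks x y → Valid x × Valid y
  Consecutive⇒Valid (pre , post , split) =
    ∈-blocks⇒Valid (subst (_ ∈_) (sym split) (∈-++⁺ʳ pre (here refl))) ,
    ∈-blocks⇒Valid (subst (_ ∈_) (sym split) (∈-++⁺ʳ pre (there (here refl))))

  phase-≡ : ∀ {x y} (vx : Valid x) (vy : Valid y) → radius x ≡ radius y → Valid.phase vx ≡ Valid.phase vy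
  phase-≡ vx vy r≡ = ≤-antisym (phase-mono vx vy (≤-reflexive r≡)) (phase-mono vy vx (≤-reflexive (sym r≡)))

  centres-apart : ∀ {x y} (vx : Valid x) → Valid y → radius x ≡ radius y → centre x < centre y →
                  centre x + spacing (Valid.phase vx) ≤ centre y
  centres-apart {x} {y} vx vy r≡ cx<cy with centre x + spacing (Valid.phase vx) ≤? centre y
  ... | yes far = far
  ... | no near = contradiction (multiples-close⇒≡ (Valid.spacing∣centre vx) (spacing∣centre-of-larger vx vy (≤-reflexive r≡))
                                   (<⇒≤ cx<cy) (≰⇒> near)) (<⇒≢ cx<cy)

  successor-same-radius : ∀ {x y} → Consecutive blocks x y → (vx : Valid x) → suc (Valid.slot vx) < cells (Valid.phase vx) ∸ 1 →
                          y ≡ (radius x , centre x + spacing (Valid.phase vx))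
  successor-same-radius {x} {y} cons vx@(valid i t a i<n t< _ refl) a+1< with ⊏-compare y (blockAt i t (suc a))
  ... | inj₁ y⊏z = contradiction (<-≤-trans (⊏-same-radius y⊏z (sym rx≡ry)) (≤-reflexive (+-comm (spacing i) (centre x))))
                                 (≤⇒≯ (centres-apart vx vy rx≡ry (⊏-same-radius (consecutive⇒≺ cons) rx≡ry)))
    where
      vy = proj₂ (Consecutive⇒Valid cons)
      rx≡ry = ≤-antisym (⊏⇒radius≤ (consecutive⇒≺ cons)) (⊏⇒radius≤ y⊏z)
  ... | inj₂ (inj₁ refl) = cong (radius x ,_) (+-comm (spacing i) (centre x))
  ... | inj₂ (inj₂ z⊏y) = contradiction z⊏y (consecutive-adjacent cons (valid i t (suc a) i<n t< a+1< refl) x⊏z)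
    where
      x⊏z = inj₂ (refl , m<n+m (centre x) (1≤2^ (suc i)))

  last-centre : ∀ {x} (vx : Valid x) → suc (Valid.slot vx) ≡ cells (Valid.phase vx) ∸ 1 → centre x + spacing (Valid.phase vx) ≡ N
  last-centre {x} (valid i t a i<n _ _ refl) a+1≡ = begin
    suc a * spacing i + spacing i        ≡⟨ +-comm (suc a * spacing i) (spacing i) ⟩
    (1 + suc a) * spacing i              ≡⟨ cong (λ k → (1 + k) * spacing i) a+1≡ ⟩
    (1 + (cells i ∸ 1)) * spacing i      ≡⟨ cong (_* spacing i) (trans (+-comm 1 (cells i ∸ 1)) (m∸n+n≡m (1≤2^ ((2 + n) ∸ i)))) ⟩
    cells i * spacing i                  ≡⟨ cells*spacing (≤-trans (<⇒≤ i<n) (m≤n+m n 2)) ⟩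
    N                                    ∎
    where open ≡-Reasoning

  next-radius-start : ∀ {x y} (vx : Valid x) → Valid y → radius x < radius y →
                      ∃ λ z → Valid z × radius z ≡ suc (radius x) × centre z ≤ spacing (Valid.phase vx) + spacing (Valid.phase vx)
  next-radius-start {x} {y} vx@(valid i t a i<n t< _ refl) vy rx<ry with suc t <? 2 ^ i
  ... | yes t+1< = blockAt i (suc t) 0 , valid i (suc t) 0 i<n t+1< (cells-1>0 i<n) refl , +-suc (2 ^ i) t ,
                   ≤-trans (≤-reflexive (+-identityʳ (spacing i))) (m≤m+n (spacing i) (spacing i))
  ... | no t+1≮ with suc i <? n
  ...   | yes i+1<n = blockAt (suc i) 0 0 , valid (suc i) 0 0 i+1<n (1≤2^ (suc i)) (cells-1>0 i+1<n) refl ,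
                      trans (+-identityʳ (2 ^ suc i)) 2^[i+1]≡r+1 ,
                      ≤-reflexive (trans (+-identityʳ (spacing (suc i))) (2^suc (suc i)))
    where
      2^[i+1]≡r+1 : 2 ^ suc i ≡ suc (2 ^ i + t)
      2^[i+1]≡r+1 = trans (2^suc i) (trans (cong (2 ^ i +_) (sym (≤-antisym t< (≮⇒≥ t+1≮)))) (+-suc (2 ^ i) t))
  ...   | no i+1≮n = contradiction (≤-<-trans rx<ry (<-≤-trans (Valid.radius<spacing vy) (Valid.spacing≤2^n vy)))
                       (≤⇒≯ (begin
                         2 ^ n              ≤⟨ ^-monoʳ-≤ 2 (≮⇒≥ i+1≮n) ⟩
                         2 ^ suc i          ≡⟨ 2^suc i ⟩
                         2 ^ i + 2 ^ i      ≡⟨ cong (2 ^ i +_) (sym (≤-antisym t< (≮⇒≥ t+1≮))) ⟩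
                         2 ^ i + suc t      ≡⟨ +-suc (2 ^ i) t ⟩
                         suc (2 ^ i + t)    ∎))
    where open ≤-Reasoning

  successor-next-radius : ∀ {x y} → Consecutive blocks x y → (vx : Valid x) → suc (Valid.slot vx) ≡ cells (Valid.phase vx) ∸ 1 →
                          centre x + spacing (Valid.phase vx) ≡ N × suc (high y) < low x
  successor-next-radius {x} {y} cons vx a+1≡ = cx+S≡N , m+n≤o⇒m≤o∸n (suc (suc (high y))) (junction-gap (Valid.radius<spacing vx) high-y≤ 8S≤N)
    where
      S = spacing (Valid.phase vx)
      vy = proj₂ (Consecutive⇒Valid cons)
      cx+S≡N = last-centre vx a+1≡
      8S≤N : 8 * S ≤ centre x + S
      8S≤N = subst (8 * S ≤_) (trans (solve 1 (λ x → con 8 :* x := con 2 :* (con 2 :* (con 2 :* x))) refl (2 ^ n)) (sym cx+S≡N))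
                   (*-monoʳ-≤ 8 (Valid.spacing≤2^n vx))
        where open +-*-Solver
      rx<ry : radius x < radius y
      rx<ry with consecutive⇒≺ cons
      ... | inj₁ rx<ry = rx<ry
      ... | inj₂ (rx≡ry , cx<cy) = contradiction cx<cy (≤⇒≯ (+-cancelʳ-≤ S (centre y) (centre x)
              (subst (λ i → centre y + spacing i ≤ centre x + S) (sym (phase-≡ vx vy rx≡ry))
                (subst (centre y + spacing (Valid.phase vy) ≤_) (sym cx+S≡N) (Valid.centre+spacing≤N vy)))))
      high-y≤ : high y ≤ (S + S) + suc (radius x)
      high-y≤ with next-radius-start vx vy rx<ry
      ... | z , vz , rz≡ , cz≤ with ⊏-compare y z
      ...   | inj₁ y⊏z = subst (_≤ (S + S) + suc (radius x)) (sym (Valid.high≡centre+radius vy))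
                           (+-mono-≤ (≤-trans (<⇒≤ (⊏-same-radius y⊏z ry≡rz)) cz≤) (≤-reflexive (trans ry≡rz rz≡)))
        where
          ry≡rz : radius y ≡ radius z
          ry≡rz = ≤-antisym (⊏⇒radius≤ y⊏z) (subst (_≤ radius y) (sym rz≡) rx<ry)
      ...   | inj₂ (inj₁ refl) = subst (_≤ (S + S) + suc (radius x)) (sym (Valid.high≡centre+radius vy)) (+-mono-≤ cz≤ (≤-reflexive rz≡))
      ...   | inj₂ (inj₂ z⊏y) = contradiction z⊏y (consecutive-adjacent cons vz (inj₁ (subst (radius x <_) (sym rz≡) ≤-refl)))

  -- Either y is the next block of the same radius, or x has the last centre and y starts the next radius near 0.
  JunctionShape : Block → Block → ℕ → Set
  JunctionShape x y S = high y ≡ low x + (S + width x) ⊎ (low x + (S + radius x) ≡ N × suc (high y) < low x)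

  junction-shape : ∀ {x y} → Consecutive blocks x y → (vx : Valid x) → JunctionShape x y (spacing (Valid.phase vx))
  junction-shape {x} {y} cons vx with suc (Valid.slot vx) <? cells (Valid.phase vx) ∸ 1
  ... | yes a+1< = inj₁ (begin
        high y                                ≡⟨ Valid.high≡centre+radius vy ⟩
        centre y + radius y                   ≡⟨ cong (λ y → centre y + radius y) y≡ ⟩
        (centre x + S) + radius x             ≡⟨ cong (λ c → (c + S) + radius x) (sym (Valid.low+radius≡centre vx)) ⟩
        ((low x + radius x) + S) + radius x   ≡⟨ solve 3 (λ l r s → ((l :+ r) :+ s) :+ r := l :+ (s :+ (r :+ r))) refl (low x) (radius x) S ⟩
        low x + (S + width x)                 ∎)
    where
      open ≡-Reasoning
      open +-*-Solver
      S = spacing (Valid.phase vx)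
      vy = proj₂ (Consecutive⇒Valid cons)
      y≡ = successor-same-radius cons vx a+1<
  ... | no a+1≮ = inj₂ (trans (cong (low x +_) (+-comm S (radius x)))
                                  (trans (sym (+-assoc (low x) (radius x) S)) (trans (cong (_+ S) (Valid.low+radius≡centre vx)) cx+S≡N)) , high<low)
    where
      S = spacing (Valid.phase vx)
      next = successor-next-radius cons vx (≤-antisym (Valid.slot< vx) (≮⇒≥ a+1≮))
      cx+S≡N = proj₁ next
      high<low = proj₂ next

  low<N : ∀ {x} → Valid x → low x < N
  low<N {x} vx = ≤-<-trans (m∸n≤m (centre x) (radius x)) (<-≤-trans (m<m+n (centre x) (1≤2^ (suc (Valid.phase vx)))) (Valid.centre+spacing≤N vx))

  junction-not-descending : ∀ {x y} → Consecutive blocks x y → suc (high y) ≢ low x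
  junction-not-descending {x} {y} cons = by-shape (junction-shape cons vx)
    where
      vx = proj₁ (Consecutive⇒Valid cons)
      S = spacing (Valid.phase vx)
      by-shape : JunctionShape x y S → suc (high y) ≢ low x
      by-shape (inj₁ high≡) = ≢-sym (<⇒≢ (s≤s (subst (low x ≤_) (sym high≡) (m≤m+n (low x) (S + width x)))))
      by-shape (inj₂ (_ , high<low)) = <⇒≢ high<low

  radius-injective : ∀ {x x′} (vx : Valid x) (vx′ : Valid x′) (g : ℕ → ℕ) → (∀ {a b} → a < b → g a < g b) →
                     spacing (Valid.phase vx) + g (radius x) ≡ spacing (Valid.phase vx′) + g (radius x′) → radius x ≡ radius x′
  radius-injective {x} {x′} vx vx′ g g-mono sum≡ with <-cmp (radius x) (radius x′)
  ... | tri< rx<rx′ _ _ = contradiction sum≡ (<⇒≢ (+-mono-≤-< (spacing-mono vx vx′ (<⇒≤ rx<rx′)) (g-mono rx<rx′)))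
  ... | tri≈ _ rx≡rx′ _ = rx≡rx′
  ... | tri> _ _ rx′<rx = contradiction (sym sum≡) (<⇒≢ (+-mono-≤-< (spacing-mono vx′ vx (<⇒≤ rx′<rx)) (g-mono rx′<rx)))

  junction-injective : ∀ {x y x′ y′} → Consecutive blocks x y → Consecutive blocks x′ y′ → low x ≡ low x′ → high y ≡ high y′ → x ≡ x′
  junction-injective {x} {y} {x′} {y′} cons cons′ low≡ high≡ = by-shape (junction-shape cons vx) (junction-shape cons′ vx′)
    where
      vx = proj₁ (Consecutive⇒Valid cons)
      vx′ = proj₁ (Consecutive⇒Valid cons′)
      S = spacing (Valid.phase vx)
      S′ = spacing (Valid.phase vx′)
      same-radius⇒≡ : radius x ≡ radius x′ → x ≡ x′
      same-radius⇒≡ r≡ = cong₂ _,_ r≡ (trans (sym (Valid.low+radius≡centre vx)) (trans (cong₂ _+_ low≡ r≡) (Valid.low+radius≡centre vx′)))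
      overlapping-and-apart : ∀ {l h l′ h′} → l ≤ h → suc h′ < l′ → l ≡ l′ → h ≡ h′ → ⊥
      overlapping-and-apart l≤h h′+1<l′ refl refl = <-irrefl refl (≤-<-trans l≤h (<-trans (n<1+n _) h′+1<l′))
      by-shape : JunctionShape x y S → JunctionShape x′ y′ S′ → x ≡ x′
      by-shape (inj₁ h) (inj₁ h′) = same-radius⇒≡ (radius-injective vx vx′ (λ r → r + r) (λ a<b → +-mono-< a<b a<b)
        (+-cancelˡ-≡ (low x) (S + width x) (S′ + width x′) (trans (sym h) (trans high≡ (trans h′ (cong (_+ (S′ + width x′)) (sym low≡)))))))
      by-shape (inj₂ (s , _)) (inj₂ (s′ , _)) = same-radius⇒≡ (radius-injective vx vx′ (λ r → r) (λ a<b → a<b)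
        (+-cancelˡ-≡ (low x) (S + radius x) (S′ + radius x′) (trans s (trans (sym s′) (cong (_+ (S′ + radius x′)) (sym low≡))))))
      by-shape (inj₁ h) (inj₂ (_ , high′<low′)) =
        ⊥-elim (overlapping-and-apart (subst (low x ≤_) (sym h) (m≤m+n _ _)) high′<low′ low≡ high≡)
      by-shape (inj₂ (_ , high<low)) (inj₁ h′) =
        ⊥-elim (overlapping-and-apart (subst (low x′ ≤_) (sym h′) (m≤m+n _ _)) high<low (sym low≡) (sym high≡))

  successor-unique : ∀ {x y y′} → Consecutive blocks x y → Consecutive blocks x y′ → y ≡ y′
  successor-unique {x} {y} {y′} cons cons′ = by-order (⊏-compare y y′)
    where
      by-order : y ⊏ y′ ⊎ y ≡ y′ ⊎ y′ ⊏ y → y ≡ y′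
      by-order (inj₁ y⊏y′) = contradiction y⊏y′ (consecutive-adjacent cons′ (proj₂ (Consecutive⇒Valid cons)) (consecutive⇒≺ cons))
      by-order (inj₂ (inj₁ y≡y′)) = y≡y′
      by-order (inj₂ (inj₂ y′⊏y)) = contradiction y′⊏y (consecutive-adjacent cons (proj₂ (Consecutive⇒Valid cons′)) (consecutive⇒≺ cons′))

module Strings (n : ℕ) where
  open Family n

  full : Block
  full = (2 ^ (2 + n) , 2 ^ (2 + n))

  low-full : low full ≡ 0
  low-full = n∸n≡0 (2 ^ (2 + n))

  width-full : width full ≡ N
  width-full = cong (2 ^ (2 + n) +_) (sym (+-identityʳ (2 ^ (2 + n))))

  high-full : high full ≡ N
  high-full = cong₂ _+_ low-full width-full

  descRun ascRun : Block → List ℕ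
  descRun b = desc (low b) (width b)
  ascRun b = asc (low b) (width b)

  length-ascRun-full : length (ascRun full) ≡ suc N
  length-ascRun-full = trans (length-asc (low full) (width full)) (cong suc width-full)

  module ↓ = Runs descRun
  module ↑ = Runs ascRun

  w↓ w↑ : Str
  w↓ = ↓.runs blocks ++ descRun full
  w↑ = ↑.runs (full ∷ reverse blocks)

  reverse-runs : ∀ bs → reverse (↓.runs bs) ≡ ↑.runs (reverse bs)
  reverse-runs [] = refl
  reverse-runs (b ∷ bs) = begin
    reverse (descRun b ++ ↓.runs bs)              ≡⟨ reverse-++ (descRun b) (↓.runs bs) ⟩
    reverse (↓.runs bs) ++ reverse (descRun b)    ≡⟨ cong₂ _++_ (reverse-runs bs) (reverse-desc (low b) (width b)) ⟩
    ↑.runs (reverse bs) ++ ascRun b               ≡⟨ cong (↑.runs (reverse bs) ++_) (sym (++-identityʳ (ascRun b))) ⟩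
    ↑.runs (reverse bs) ++ ↑.runs [ b ]           ≡⟨ sym (concatMap-++ ascRun (reverse bs) [ b ]) ⟩
    ↑.runs (reverse bs ++ [ b ])                  ≡⟨ cong ↑.runs (sym (unfold-reverse b bs)) ⟩
    ↑.runs (reverse (b ∷ bs))                     ∎
    where open ≡-Reasoning

  reverse-w↑ : reverse w↑ ≡ w↓
  reverse-w↑ = begin
    reverse w↑
      ≡⟨ cong reverse (cong₂ _++_ (sym (reverse-desc (low full) (width full))) (sym (reverse-runs blocks))) ⟩
    reverse (reverse (descRun full) ++ reverse (↓.runs blocks))
      ≡⟨ cong reverse (sym (reverse-++ (↓.runs blocks) (descRun full))) ⟩
    reverse (reverse w↓)
      ≡⟨ reverse-involutive w↓ ⟩
    w↓                                                  ∎
    where open ≡-Reasoning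

  length-w↓ : length w↓ ≡ length (↓.runs blocks) + suc N
  length-w↓ = trans (length-++ (↓.runs blocks)) (cong (length (↓.runs blocks) +_) (trans (length-desc (low full) (width full)) (cong suc width-full)))

  length-runs-snoc : ∀ pre b → length (↓.runs (pre ++ [ b ])) ≡ length (↓.runs pre) + suc (width b)
  length-runs-snoc pre b = trans (↓.length-runs-++-[] pre b) (cong (length (↓.runs pre) +_) (length-desc (low b) (width b)))

  w↓-split : ∀ {pre b post} → blocks ≡ pre ++ b ∷ post → w↓ ≡ ↓.runs pre ++ (descRun b ++ (↓.runs post ++ descRun full))
  w↓-split split = ↓.runs-split (descRun full) split

  drop-w↓ : ∀ {pre b post} k → blocks ≡ pre ++ b ∷ post → k ≤ width b →
           drop (length (↓.runs pre) + k) w↓ ≡ drop k (descRun b) ++ (↓.runs post ++ descRun full)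
  drop-w↓ k split k≤w = ↓.drop-runs k (descRun full) split (subst (k ≤_) (sym (length-desc _ _)) (m≤n⇒m≤1+n k≤w))

  cover⇒earlier-occurrence : ∀ {pre b post y e} → blocks ≡ pre ++ b ∷ post → EarlierCover b y e →
                             ∃ λ s → s + suc e ≤ length (↓.runs pre) × ∃ λ T → drop s w↓ ≡ desc y e ++ T
  cover⇒earlier-occurrence {pre} {b} {post} {y} {e} split (cover {x} vx x⊏b low≤ ≤high) with ∈-∃++ (≺⇒∈before split vx x⊏b)
  ... | A , C , refl with desc-window low≤ ≤high
  ...   | k , k+e<w , T , drop≡ = length (↓.runs A) + k , s+e≤ , T ++ rest , occurrence
    where
      rest = ↓.runs (C ++ b ∷ post) ++ descRun full
      split′ : blocks ≡ A ++ x ∷ (C ++ b ∷ post)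
      split′ = trans split (++-assoc A (x ∷ C) (b ∷ post))
      occurrence : drop (length (↓.runs A) + k) w↓ ≡ desc y e ++ T ++ rest
      occurrence = begin
          drop (length (↓.runs A) + k) w↓   ≡⟨ drop-w↓ k split′ (s≤s⁻¹ (≤-trans (m≤m+n (suc k) e) (subst (_≤ suc (width x)) (+-suc k e) k+e<w))) ⟩
          drop k (descRun x) ++ rest       ≡⟨ cong (_++ rest) drop≡ ⟩
          (desc y e ++ T) ++ rest          ≡⟨ ++-assoc (desc y e) T rest ⟩
          desc y e ++ T ++ rest            ∎
        where open ≡-Reasoning
      s+e≤ : length (↓.runs A) + k + suc e ≤ length (↓.runs (A ++ x ∷ C))
      s+e≤ = begin
        length (↓.runs A) + k + suc e
          ≡⟨ +-assoc (length (↓.runs A)) k (suc e) ⟩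
        length (↓.runs A) + (k + suc e)
          ≤⟨ +-monoʳ-≤ (length (↓.runs A)) (subst (k + suc e ≤_) (sym (length-desc (low x) (width x))) k+e<w) ⟩
        length (↓.runs A) + length (descRun x)
          ≤⟨ +-monoʳ-≤ (length (↓.runs A)) (length-++-≤ˡ (descRun x)) ⟩
        length (↓.runs A) + length (↓.runs (x ∷ C))
          ≡⟨ sym (trans (cong length (concatMap-++ descRun A (x ∷ C))) (length-++ (↓.runs A))) ⟩
        length (↓.runs (A ++ x ∷ C))                      ∎
        where open ≤-Reasoning

  descRun-thirds : ∀ {b r′} → Valid b → radius b ≡ suc r′ →
                   descRun b ≡ desc (suc (centre b)) r′ ++ desc (suc (low b)) r′ ++ [ low b ]
  descRun-thirds {b} {r′} vb r≡ = begin
    desc (low b) (radius b + radius b)                              ≡⟨ cong (λ r → desc (low b) (r + r)) r≡ ⟩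
    desc (low b) (suc r′ + suc r′)                                  ≡⟨ cong (desc (low b)) (sym (+-suc r′ (suc r′))) ⟩
    desc (low b) (r′ + suc (suc r′))                                ≡⟨ desc-++ (low b) r′ (suc r′) ⟩
    desc (low b + suc (suc r′)) r′ ++ desc (low b) (suc r′)
      ≡⟨ cong₂ (λ x y → desc x r′ ++ y) top≡ (trans (cong (desc (low b)) (+-comm 1 r′)) (desc-++ (low b) r′ 0)) ⟩
    desc (suc (centre b)) r′ ++ desc (low b + 1) r′ ++ [ low b ]
      ≡⟨ cong (λ x → desc (suc (centre b)) r′ ++ desc x r′ ++ [ low b ]) (+-comm (low b) 1) ⟩
    desc (suc (centre b)) r′ ++ desc (suc (low b)) r′ ++ [ low b ]  ∎
    where
      open ≡-Reasoning
      top≡ : low b + suc (suc r′) ≡ suc (centre b)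
      top≡ = trans (+-suc (low b) (suc r′)) (cong suc (trans (cong (low b +_) (sym r≡)) (Valid.low+radius≡centre vb)))

  module P↓ = Parsing w↓

  radius-pred : ∀ {b} → Valid b → radius b ≡ suc (pred (radius b))
  radius-pred {b} vb = sym (suc-pred (radius b) {{>-nonZero (Valid.1≤radius vb)}})

  copy-desc : ∀ {s q y e xs ys} → s + suc e ≤ q → drop s w↓ ≡ desc y e ++ xs → drop q w↓ ≡ desc y e ++ ys →
              P↓.Factorization (q + suc e) → P↓.Factorization q
  copy-desc {s} {q} {y} {e} s+ℓ≤q ds dq =
    P↓.copy (suc e) s s+ℓ≤q (subst (_≤ lce w↓ s q) (length-desc y e) (lce-≥-shared-prefix {w↓} {s} {q} (desc y e) ds dq))

  thirds-in-w↓ : ∀ {pre b post ρ} → blocks ≡ pre ++ b ∷ post → Valid b → radius b ≡ suc ρ →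
                let o = length (↓.runs pre) ; rest = [ low b ] ++ ↓.runs post ++ descRun full in
                drop o w↓ ≡ desc (suc (centre b)) ρ ++ (desc (suc (low b)) ρ ++ rest) ×
                drop (o + suc ρ) w↓ ≡ desc (suc (low b)) ρ ++ rest
  thirds-in-w↓ {pre} {b} {post} {ρ} split vb r≡ = at-start , at-middle
    where
      open ≡-Reasoning
      o = length (↓.runs pre)
      rest = [ low b ] ++ ↓.runs post ++ descRun full
      upper-half = desc (suc (centre b)) ρ
      lower-half = desc (suc (low b)) ρ ++ [ low b ]
      middle = desc (suc (low b)) ρ ++ rest
      run≡ : descRun b ++ ↓.runs post ++ descRun full ≡ upper-half ++ middle
      run≡ = trans (cong (_++ ↓.runs post ++ descRun full) (descRun-thirds vb r≡))
               (trans (++-assoc upper-half lower-half _) (cong (upper-half ++_) (++-assoc (desc (suc (low b)) ρ) [ low b ] _)))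
      at-start : drop o w↓ ≡ upper-half ++ (desc (suc (low b)) ρ ++ rest)
      at-start = trans (cong (λ q → drop q w↓) (sym (+-identityʳ o))) (trans (drop-w↓ 0 split z≤n) run≡)
      at-middle : drop (o + suc ρ) w↓ ≡ desc (suc (low b)) ρ ++ rest
      at-middle = begin
        drop (o + suc ρ) w↓
          ≡⟨ cong (drop (o + suc ρ)) (trans (w↓-split split) (cong (↓.runs pre ++_) run≡)) ⟩
        drop (o + suc ρ) (↓.runs pre ++ upper-half ++ middle)
          ≡⟨ drop-++ʳ (suc ρ) (↓.runs pre) (upper-half ++ middle) ⟩
        drop (suc ρ) (upper-half ++ middle)
          ≡⟨ subst (λ k → drop k (upper-half ++ middle) ≡ middle) (length-desc (suc (centre b)) ρ) (drop-++-length upper-half middle) ⟩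
        desc (suc (low b)) ρ ++ rest                                ∎

  -- Two copies from the covers of the shortened halves, and the last letter on its own.
  block-phrases : ∀ {pre b post} → blocks ≡ pre ++ b ∷ post → (φ : P↓.Factorization (length (↓.runs (pre ++ [ b ])))) →
                  Σ (P↓.Factorization (length (↓.runs pre))) λ ψ → P↓.size ψ ≡ 3 + P↓.size φ
  block-phrases {pre} {b} {post} split φ = by-radius (pred (radius b)) (radius-pred vb)
    where
      vb = ∈-blocks⇒Valid (∈-split split)
      o = length (↓.runs pre)
      end≡ : ∀ {ρ} → radius b ≡ suc ρ → length (↓.runs (pre ++ [ b ])) ≡ suc ((o + suc ρ) + suc ρ)
      end≡ {ρ} r≡ = begin
        length (↓.runs (pre ++ [ b ]))           ≡⟨ length-runs-snoc pre b ⟩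
        o + suc (width b)                        ≡⟨ cong (λ r → o + suc (r + r)) r≡ ⟩
        o + suc (suc ρ + suc ρ)                  ≡⟨ +-suc o _ ⟩
        suc (o + (suc ρ + suc ρ))                ≡⟨ cong suc (sym (+-assoc o (suc ρ) (suc ρ))) ⟩
        suc ((o + suc ρ) + suc ρ)                ∎
        where open ≡-Reasoning
      by-radius : ∀ ρ → radius b ≡ suc ρ → Σ (P↓.Factorization o) λ ψ → P↓.size ψ ≡ 3 + P↓.size φ
      by-radius zero r≡ = P↓.letter (P↓.letter (P↓.letter (subst P↓.Factorization end≡′ φ))) , cong (3 +_) (P↓.size-subst end≡′ φ)
        where
          end≡′ : length (↓.runs (pre ++ [ b ])) ≡ 3 + o
          end≡′ = trans (end≡ r≡) (cong suc (trans (+-assoc o 1 1) (+-comm o 2)))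
      by-radius ρ@(suc _) r≡ =
        copy-desc (proj₁ (proj₂ upper)) (proj₂ (proj₂ (proj₂ upper))) (proj₁ thirds)
          (copy-desc (≤-trans (proj₁ (proj₂ lower)) (m≤m+n o (suc ρ))) (proj₂ (proj₂ (proj₂ lower))) (proj₂ thirds)
            (P↓.letter (subst P↓.Factorization (end≡ r≡) φ))) ,
        cong (3 +_) (P↓.size-subst (end≡ r≡) φ)
        where
          upper = cover⇒earlier-occurrence split (upper-cover vb r≡ (s≤s z≤n))
          lower = cover⇒earlier-occurrence split (lower-cover vb r≡ (s≤s z≤n))
          thirds = thirds-in-w↓ split vb r≡

  factorization-w↓ : ∀ pre post → blocks ≡ pre ++ post →
                    Σ (P↓.Factorization (length (↓.runs pre))) λ φ → P↓.size φ ≡ 3 * length post + suc N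
  factorization-w↓ pre [] split with P↓.letters (suc N) (P↓.done (≤-reflexive
    (trans length-w↓ (cong (λ bs → length (↓.runs bs) + suc N) (trans split (++-identityʳ pre))))))
  ... | φ , size≡ = φ , trans size≡ (+-identityʳ (suc N))
  factorization-w↓ pre (b ∷ post) split with factorization-w↓ (pre ++ [ b ]) post (trans split (sym (++-assoc pre [ b ] post)))
  ... | φ , size≡ with block-phrases split φ
  ...   | ψ , size≡′ = ψ , trans size≡′ (trans (cong (3 +_) size≡)
            (sym (trans (cong (_+ suc N) (*-suc 3 (length post))) (+-assoc 3 (3 * length post) (suc N)))))

  breaks-after : ∀ {A x rest} → blocks ≡ A ++ x ∷ rest → BreaksDesc (low x) (↓.runs rest ++ descRun full)
  breaks-after {A} {x} {[]} split {v} eq v+1≡low with desc-head (low full) (width full)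
  ... | tl , head≡ = <-irrefl refl (<-trans (subst (_< N) (sym v+1≡low) (low<N (∈-blocks⇒Valid (∈-split split))))
                                            (subst (_< suc v) (sym N≡v) (n<1+n v)))
    where
      N≡v : N ≡ v
      N≡v = trans (sym high-full) (proj₁ (∷-injective (trans (sym head≡) eq)))
  breaks-after {A} {x} {y ∷ rest} split {v} eq v+1≡low with desc-head (low y) (width y)
  ... | tl , head≡ = junction-not-descending (A , rest , split) (trans (cong suc high≡v) v+1≡low)
    where
      high≡v : high y ≡ v
      high≡v = proj₁ (∷-injective (trans (trans (sym (cong (_++ (↓.runs rest ++ descRun full)) head≡))
                 (sym (++-assoc (descRun y) (↓.runs rest) (descRun full)))) eq))

  -- Junctions never continue a descent, so an earlier occurrence lies within a single run.
  earlier-occurrence⇒cover : ∀ {pre b post s y e} → blocks ≡ pre ++ b ∷ post → s < length (↓.runs pre) →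
                             take (suc e) (drop s w↓) ≡ desc y e → EarlierCover b y e
  earlier-occurrence⇒cover {pre} {b} {post} {s} {y} {e} split s<pre take≡ =
    cover (∈-blocks⇒Valid (∈-split split′)) (∈before⇒≺ split block∈pre) (proj₁ bounds)
      (≤-trans (proj₂ bounds) (+-monoʳ-≤ (low block) (m∸n≤m (width block) offset)))
    where
      R = descRun b ++ (↓.runs post ++ descRun full)
      open ↓.Location (↓.locate pre s<pre)
      split′ : blocks ≡ before ++ block ∷ (after ++ b ∷ post)
      split′ = trans split (trans (cong (_++ b ∷ post) located) (++-assoc before (block ∷ after) (b ∷ post)))
      block∈pre : block ∈ pre
      block∈pre = subst (block ∈_) (sym located) (∈-++⁺ʳ before (here refl))
      rest≡ : ↓.runs after ++ R ≡ ↓.runs (after ++ b ∷ post) ++ descRun full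
      rest≡ = sym (trans (cong (_++ descRun full) (concatMap-++ descRun after (b ∷ post)))
                (trans (++-assoc (↓.runs after) _ (descRun full)) (cong (↓.runs after ++_) (++-assoc (descRun b) (↓.runs post) (descRun full)))))
      drop≡ : drop s w↓ ≡ desc (low block) (width block ∸ offset) ++ (↓.runs after ++ R)
      drop≡ = trans (cong (drop s) (w↓-split split)) (trans (drop-at R) (cong (_++ (↓.runs after ++ R)) (drop-desc-≤ (low block) offset≤)))
        where offset≤ = s≤s⁻¹ (subst (offset <_) (length-desc (low block) (width block)) inside)
      bounds : low block ≤ y × y + e ≤ low block + (width block ∸ offset)
      bounds = desc-infix (low block) (width block ∸ offset) (↓.runs after ++ R)
                 (subst (BreaksDesc (low block)) (sym rest≡) (breaks-after split′)) (trans (cong (take (suc e)) (sym drop≡)) take≡)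

  descRun-halves : ∀ {b ρ} → radius b ≡ suc ρ → Valid b → descRun b ≡ desc (centre b) (radius b) ++ desc (low b) ρ
  descRun-halves {b} {ρ} r≡ vb = begin
    desc (low b) (radius b + radius b)                     ≡⟨ cong (λ r → desc (low b) (radius b + r)) r≡ ⟩
    desc (low b) (radius b + suc ρ)                        ≡⟨ desc-++ (low b) (radius b) ρ ⟩
    desc (low b + suc ρ) (radius b) ++ desc (low b) ρ      ≡⟨ cong (λ x → desc x (radius b) ++ desc (low b) ρ) low+r≡ ⟩
    desc (centre b) (radius b) ++ desc (low b) ρ           ∎
    where
      open ≡-Reasoning
      low+r≡ : low b + suc ρ ≡ centre b
      low+r≡ = trans (cong (low b +_) (sym r≡)) (Valid.low+radius≡centre vb)

  drop-descRun-radius : ∀ b → drop (radius b) (descRun b) ≡ desc (low b) (radius b)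
  drop-descRun-radius b = trans (drop-desc-≤ (low b) (m≤m+n (radius b) (radius b))) (cong (desc (low b)) (m+n∸m≡n (radius b) (radius b)))

  take-desc-++ : ∀ y e xs → take (suc e) (desc y e ++ xs) ≡ desc y e
  take-desc-++ y e xs = subst (λ k → take k (desc y e ++ xs) ≡ desc y e) (length-desc y e) (take-++-length (desc y e) xs)

  upper-window-novel : ∀ {pre b post} → blocks ≡ pre ++ b ∷ post →
                       P↓.Novel (length (↓.runs pre)) (length (↓.runs pre) + radius b)
  upper-window-novel {pre} {b} {post} split = P↓.no-earlier-occurrence⇒Novel (radius b) earlier
    where
      o = length (↓.runs pre)
      r = radius b
      vb = ∈-blocks⇒Valid (∈-split split)
      rest = ↓.runs post ++ descRun full
      lower = desc (low b) (pred r)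
      take-o : take (suc r) (drop o w↓) ≡ desc (centre b) r
      take-o = begin
        take (suc r) (drop o w↓)
          ≡⟨ cong (λ k → take (suc r) (drop k w↓)) (sym (+-identityʳ o)) ⟩
        take (suc r) (drop (o + 0) w↓)
          ≡⟨ cong (take (suc r)) (drop-w↓ 0 split z≤n) ⟩
        take (suc r) (descRun b ++ rest)
          ≡⟨ cong (λ xs → take (suc r) (xs ++ rest)) (descRun-halves (radius-pred vb) vb) ⟩
        take (suc r) ((desc (centre b) r ++ lower) ++ rest)
          ≡⟨ cong (take (suc r)) (++-assoc (desc (centre b) r) lower rest) ⟩
        take (suc r) (desc (centre b) r ++ (lower ++ rest))
          ≡⟨ take-desc-++ (centre b) r (lower ++ rest) ⟩
        desc (centre b) r                                               ∎
        where open ≡-Reasoning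
      earlier : ∀ {s} → s < o → take (suc r) (drop s w↓) ≢ take (suc r) (drop o w↓)
      earlier {s} s<o take≡ = upper-half-uncovered vb
        (earlier-occurrence⇒cover split s<o (trans take≡ take-o))

  -- Inside its own run, the lower half of b is preceded only by letters above the centre.
  lower-half-not-in-upper-half : ∀ {pre b post} → blocks ≡ pre ++ b ∷ post → ∀ {k} → k < radius b →
                                 take (suc (radius b)) (drop (length (↓.runs pre) + k) w↓) ≢ desc (low b) (radius b)
  lower-half-not-in-upper-half {pre} {b} {post} split {k} k<r take≡ = <-irrefl k≡r k<r
    where
      r = radius b
      k≤w = ≤-trans (<⇒≤ k<r) (m≤m+n r r)
      drop≡ : drop (length (↓.runs pre) + k) w↓ ≡ low b + (width b ∸ k) ∷ (proj₁ (desc-head (low b) (width b ∸ k)) ++ (↓.runs post ++ descRun full))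
      drop≡ = trans (drop-w↓ k split k≤w) (cong (_++ (↓.runs post ++ descRun full))
                (trans (drop-desc-≤ (low b) k≤w) (proj₂ (desc-head (low b) (width b ∸ k)))))
      heads : low b + (width b ∸ k) ≡ low b + r
      heads = proj₁ (∷-injective (trans (sym (cong (take (suc r)) drop≡)) (trans take≡ (proj₂ (desc-head (low b) r)))))
      k≡r : k ≡ r
      k≡r = +-cancelʳ-≡ r k r (trans (cong (k +_) (sym (+-cancelˡ-≡ (low b) (width b ∸ k) r heads))) (m+[n∸m]≡n k≤w))

  lower-window-novel : ∀ {pre b post} → blocks ≡ pre ++ b ∷ post →
                       P↓.Novel (length (↓.runs pre) + radius b) (length (↓.runs pre) + radius b + radius b)
  lower-window-novel {pre} {b} {post} split = P↓.no-earlier-occurrence⇒Novel (radius b) earlier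
    where
      o = length (↓.runs pre)
      r = radius b
      vb = ∈-blocks⇒Valid (∈-split split)
      take-or : take (suc r) (drop (o + r) w↓) ≡ desc (low b) r
      take-or = trans (cong (take (suc r)) (trans (drop-w↓ r split (m≤m+n r r)) (cong (_++ (↓.runs post ++ descRun full)) (drop-descRun-radius b))))
                      (take-desc-++ (low b) r (↓.runs post ++ descRun full))
      earlier : ∀ {s} → s < o + r → take (suc r) (drop s w↓) ≢ take (suc r) (drop (o + r) w↓)
      earlier {s} s<or take≡ with s <? o
      ... | yes s<o = lower-half-uncovered vb (earlier-occurrence⇒cover split s<o (trans take≡ take-or))
      ... | no s≮o = lower-half-not-in-upper-half split (+-cancelˡ-< o (s ∸ o) r (subst (_< o + r) (sym o+k≡s) s<or))
                       (subst (λ q → take (suc r) (drop q w↓) ≡ desc (low b) r) (sym o+k≡s) (trans take≡ take-or))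
        where o+k≡s = m+[n∸m]≡n (≮⇒≥ s≮o)

  module ↓J = Junctions descRun high low (λ u v → suc v ≡ u)
    (λ b R → proj₁ (desc-head (low b) (width b)) ++ R , cong (_++ R) (proj₂ (desc-head (low b) (width b))))
    (λ b → desc-run-pair (low b) (width b))

  junction-window-novel : ∀ {pre a b post} → blocks ≡ pre ++ a ∷ b ∷ post →
                          P↓.Novel (length (↓.runs pre) + width a) (length (↓.runs pre) + width a + 1)
  junction-window-novel {pre} {a} {b} {post} split = P↓.no-earlier-occurrence⇒Novel 1 earlier
    where
      i = length (↓.runs pre) + width a
      take-i : take 2 (drop i w↓) ≡ low a ∷ high b ∷ []
      take-i = cong (take 2) (begin
        drop i w↓
          ≡⟨ drop-w↓ (width a) split ≤-refl ⟩
        drop (width a) (descRun a) ++ ↓.runs (b ∷ post) ++ descRun full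
          ≡⟨ cong (_++ (↓.runs (b ∷ post) ++ descRun full)) (drop-desc-all (low a) (width a)) ⟩
        low a ∷ (descRun b ++ ↓.runs post) ++ descRun full
          ≡⟨ cong (λ xs → low a ∷ (xs ++ ↓.runs post) ++ descRun full) (proj₂ (desc-head (low b) (width b))) ⟩
        low a ∷ high b ∷ (proj₁ (desc-head (low b) (width b)) ++ ↓.runs post) ++ descRun full ∎)
        where open ≡-Reasoning
      a∉pre : a ∉ pre
      a∉pre a∈pre = ⊏-irrefl (∈before⇒≺ split a∈pre)
      earlier : ∀ {s} → s < i → take 2 (drop s w↓) ≢ take 2 (drop i w↓)
      earlier {s} s<i take≡ =
        ↓J.junction-first-occurrence (descRun full) split a∉pre (junction-not-descending (pre , post , split))
          (λ cons low≡ high≡ → junction-injective cons (pre , post , split) low≡ high≡)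
          (subst (suc s <_) (trans (sym (+-suc (length (↓.runs pre)) (width a))) (cong (length (↓.runs pre) +_) (sym (length-desc (low a) (width a))))) (s≤s s<i))
          (trans take≡ take-i)

  block-end<length-w↓ : ∀ {pre b post} → blocks ≡ pre ++ b ∷ post → length (↓.runs pre) + suc (width b) < length w↓
  block-end<length-w↓ {pre} {b} {post} split = subst (length (↓.runs pre) + suc (width b) <_) (sym length≡)
    (+-monoʳ-< (length (↓.runs pre)) (m<m+n (suc (width b)) (≤-trans (s≤s z≤n) (m≤n+m (suc N) (length (↓.runs post))))))
    where
      length≡ : length w↓ ≡ length (↓.runs pre) + (suc (width b) + (length (↓.runs post) + suc N))
      length≡ = trans (cong length (w↓-split split)) (trans (length-++ (↓.runs pre)) (cong (length (↓.runs pre) +_)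
        (trans (length-++ (descRun b)) (cong₂ _+_ (length-desc (low b) (width b))
          (trans (length-++ (↓.runs post)) (cong (length (↓.runs post) +_) (trans (length-desc (low full) (width full)) (cong suc width-full))))))))

  novel-windows-w↓ : ∀ pre b post → blocks ≡ pre ++ b ∷ post → P↓.NovelWindows (length (↓.runs pre)) (2 + 3 * length post)
  novel-windows-w↓ pre b post split =
    (≤-refl , m<m+n o 1≤r , <-trans (m<m+n (o + r) 1≤r) or+r<w↓ , upper-window-novel split) P↓.∷
    (≤-refl , m<m+n (o + r) 1≤r , or+r<w↓ , lower-window-novel split) P↓.∷ junctions post split
    where
      o = length (↓.runs pre)
      r = radius b
      1≤r = Valid.1≤radius (∈-blocks⇒Valid (∈-split split))
      i = o + width b
      o+r+r≡i : o + r + r ≡ i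
      o+r+r≡i = +-assoc o r r
      end≡ : o + suc (width b) ≡ i + 1
      end≡ = trans (+-suc o (width b)) (+-comm 1 i)
      i+1<w↓ : i + 1 < length w↓
      i+1<w↓ = subst (_< length w↓) end≡ (block-end<length-w↓ split)
      or+r<w↓ : o + r + r < length w↓
      or+r<w↓ = subst (_< length w↓) (sym o+r+r≡i) (<-trans (m<m+n i z<s) i+1<w↓)
      junctions : ∀ post → blocks ≡ pre ++ b ∷ post → P↓.NovelWindows (o + r + r) (3 * length post)
      junctions [] _ = P↓.[]
      junctions (b′ ∷ post′) split′ = subst (P↓.NovelWindows (o + r + r)) (sym (*-suc 3 (length post′)))
        ((≤-reflexive o+r+r≡i , m<m+n i z<s , i+1<w↓ , junction-window-novel split′) P↓.∷
         P↓.weaken (≤-reflexive (sym (trans (length-runs-snoc pre b) end≡)))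
           (novel-windows-w↓ (pre ++ [ b ]) b′ post′ (trans split′ (sym (++-assoc pre [ b ] (b′ ∷ post′))))))

  module P↑ = Parsing w↑

  drop-w↑ : ∀ {A v C} k → full ∷ reverse blocks ≡ A ++ v ∷ C → k ≤ width v →
           drop (length (↑.runs A) + k) w↑ ≡ drop k (ascRun v) ++ ↑.runs C
  drop-w↑ {A} {v} {C} k split k≤w = begin
    drop (length (↑.runs A) + k) w↑           ≡⟨ cong (drop (length (↑.runs A) + k)) (sym (++-identityʳ w↑)) ⟩
    drop (length (↑.runs A) + k) (w↑ ++ [])   ≡⟨ ↑.drop-runs k [] split (subst (k ≤_) (sym (length-asc (low v) (width v))) (m≤n⇒m≤1+n k≤w)) ⟩
    drop k (ascRun v) ++ (↑.runs C ++ [])    ≡⟨ cong (drop k (ascRun v) ++_) (++-identityʳ (↑.runs C)) ⟩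
    drop k (ascRun v) ++ ↑.runs C            ∎
    where open ≡-Reasoning

  split-reverse⇒Valid : ∀ {m v C} → reverse blocks ≡ m ++ v ∷ C → Valid v
  split-reverse⇒Valid {m} split = ∈-blocks⇒Valid (reverse⁻ (subst (_ ∈_) (sym split) (∈-++⁺ʳ m (here refl))))

  source-in-full : ∀ {v} → Valid v → ∃ λ T → drop (low v) w↑ ≡ ascRun v ++ T
  source-in-full {v} vv = asc (low v + suc (width v)) (N ∸ suc (high v)) ++ ↑.runs (reverse blocks) , (begin
    drop (low v) w↑
      ≡⟨ cong (λ l → drop (low v) (asc l (width full) ++ ↑.runs (reverse blocks))) low-full ⟩
    drop (low v) (asc 0 (width full) ++ ↑.runs (reverse blocks))
      ≡⟨ cong (λ w → drop (low v) (asc 0 w ++ ↑.runs (reverse blocks))) width≡ ⟩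
    drop (low v) (asc 0 (low v + (width v + suc e)) ++ ↑.runs (reverse blocks))
      ≡⟨ drop-++ˡ (low v) _ _ (subst (low v ≤_) (sym (length-asc 0 _)) (m≤n⇒m≤1+n (m≤m+n (low v) _))) ⟩
    drop (low v) (asc 0 (low v + (width v + suc e))) ++ ↑.runs (reverse blocks)
      ≡⟨ cong (_++ ↑.runs (reverse blocks)) (drop-asc (low v) 0 (width v + suc e)) ⟩
    asc (low v + 0) (width v + suc e) ++ ↑.runs (reverse blocks)
      ≡⟨ cong (λ l → asc l (width v + suc e) ++ ↑.runs (reverse blocks)) (+-identityʳ (low v)) ⟩
    asc (low v) (width v + suc e) ++ ↑.runs (reverse blocks)
      ≡⟨ cong (_++ ↑.runs (reverse blocks)) (asc-++ (low v) (width v) e) ⟩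
    (ascRun v ++ asc (low v + suc (width v)) e) ++ ↑.runs (reverse blocks)
      ≡⟨ ++-assoc (ascRun v) _ _ ⟩
    ascRun v ++ asc (low v + suc (width v)) e ++ ↑.runs (reverse blocks)    ∎)
    where
      open ≡-Reasoning
      e = N ∸ suc (high v)
      width≡ : width full ≡ low v + (width v + suc e)
      width≡ = trans width-full (sym (trans (sym (+-assoc (low v) (width v) (suc e))) (trans (+-suc (high v) e) (m+[n∸m]≡n (Valid.high<N vv)))))

  factorization-w↑ : ∀ m C → reverse blocks ≡ m ++ C → Σ (P↑.Factorization (length (↑.runs (full ∷ m)))) λ φ → P↑.size φ ≡ length C
  factorization-w↑ m [] split = P↑.done (≤-reflexive (cong (λ bs → length (↑.runs (full ∷ bs))) (trans split (++-identityʳ m)))) , refl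
  factorization-w↑ m (v ∷ C) split with factorization-w↑ (m ++ [ v ]) C (trans split (sym (++-assoc m [ v ] C)))
  ... | φ , size≡ = P↑.copy (suc (width v)) (low v) src≤ lce≥ (subst P↑.Factorization end≡ φ) , cong suc (trans (P↑.size-subst end≡ φ) size≡)
    where
      p = length (↑.runs (full ∷ m))
      vv = split-reverse⇒Valid split
      N<p : N < p
      N<p = subst (N <_) (sym (trans (length-++ (ascRun full)) (cong (_+ length (↑.runs m)) length-ascRun-full))) (m≤m+n (suc N) _)
      src≤ : low v + suc (width v) ≤ p
      src≤ = subst (_≤ p) (sym (+-suc (low v) (width v))) (<-trans (Valid.high<N vv) N<p)
      drop-p : drop p w↑ ≡ ascRun v ++ ↑.runs C
      drop-p = trans (cong (λ k → drop k w↑) (sym (+-identityʳ p))) (drop-w↑ {full ∷ m} {v} {C} 0 (cong (full ∷_) split) z≤n)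
      lce≥ : suc (width v) ≤ lce w↑ (low v) p
      lce≥ = subst (_≤ lce w↑ (low v) p) (length-asc (low v) (width v)) (lce-≥-shared-prefix {w↑} {low v} {p} (ascRun v) (proj₂ (source-in-full vv)) drop-p)
      end≡ : length (↑.runs (full ∷ m ++ [ v ])) ≡ p + suc (width v)
      end≡ = trans (↑.length-runs-++-[] (full ∷ m) v) (cong (p +_) (length-asc (low v) (width v)))

  module ↑J = Junctions ascRun low high (λ u v → v ≡ suc u)
    (λ b R → proj₁ (asc-head (low b) (width b)) ++ R , cong (_++ R) (proj₂ (asc-head (low b) (width b))))
    (λ b → asc-run-pair (low b) (width b))

  full∉blocks : ∀ {u} → Valid u → u ≢ full
  full∉blocks vu refl = <⇒≱ (<-≤-trans (Valid.radius<spacing vu) (≤-trans (Valid.spacing≤2^n vu) (^-monoʳ-≤ 2 (m≤n+m n 2)))) ≤-refl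

  junction-window-novel-w↑ : ∀ {m u v C} → reverse blocks ≡ m ++ u ∷ v ∷ C →
                            P↑.Novel (length (↑.runs (full ∷ m)) + width u) (length (↑.runs (full ∷ m)) + width u + 1)
  junction-window-novel-w↑ {m} {u} {v} {C} split = P↑.no-earlier-occurrence⇒Novel 1 earlier
    where
      p = length (↑.runs (full ∷ m))
      i = p + width u
      split′ : full ∷ reverse blocks ≡ (full ∷ m) ++ u ∷ v ∷ C
      split′ = cong (full ∷_) split
      vu = split-reverse⇒Valid split
      v-u : Consecutive blocks v u
      v-u = Consecutive-reverse (m , C , split)
      take-i : take 2 (drop i w↑) ≡ high u ∷ low v ∷ []
      take-i = cong (take 2) (begin
        drop i w↑                                       ≡⟨ drop-w↑ {full ∷ m} {u} {v ∷ C} (width u) split′ ≤-refl ⟩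
        drop (width u) (ascRun u) ++ ↑.runs (v ∷ C)    ≡⟨ cong (_++ ↑.runs (v ∷ C)) (drop-asc-all (low u) (width u)) ⟩
        high u ∷ (ascRun v ++ ↑.runs C)                ≡⟨ cong (λ xs → high u ∷ (xs ++ ↑.runs C)) (proj₂ (asc-head (low v) (width v))) ⟩
        high u ∷ low v ∷ (proj₁ (asc-head (low v) (width v)) ++ ↑.runs C) ∎)
        where open ≡-Reasoning
      u∉ : u ∉ full ∷ m
      u∉ (here u≡full) = full∉blocks vu u≡full
      u∉ (there u∈m) = ⊏-irrefl (∈after⇒≻ (reverse-split split) (reverse⁺ u∈m))
      same-junction : ∀ {z w} → Consecutive (full ∷ reverse blocks) z w → high z ≡ high u → low w ≡ low v → z ≡ u
      same-junction ([] , l₂ , eq) high≡ _ =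
        contradiction (trans (sym high-full) (trans (cong high (proj₁ (∷-injective eq))) high≡)) (≢-sym (<⇒≢ (Valid.high<N vu)))
      same-junction (_ ∷ l₁ , l₂ , eq) high≡ low≡ =
        successor-unique (subst (λ y → Consecutive blocks y _) w≡v w-z) v-u
        where
          w-z = Consecutive-reverse (l₁ , l₂ , proj₂ (∷-injective eq))
          w≡v = junction-injective w-z v-u low≡ high≡
      earlier : ∀ {s} → s < i → take 2 (drop s w↑) ≢ take 2 (drop i w↑)
      earlier {s} s<i take≡ =
        ↑J.junction-first-occurrence [] split′ u∉ (λ step → junction-not-descending v-u (sym step))
          same-junction
          (subst (suc s <_) (trans (sym (+-suc p (width u))) (cong (p +_) (sym (length-asc (low u) (width u))))) (s≤s s<i))
          (trans (cong (λ w → take 2 (drop s w)) (++-identityʳ w↑)) (trans take≡ take-i))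

  novel-windows-w↑ : ∀ m u C → reverse blocks ≡ m ++ u ∷ C → P↑.NovelWindows (length (↑.runs (full ∷ m))) (length C)
  novel-windows-w↑ m u [] split = P↑.[]
  novel-windows-w↑ m u (v ∷ C) split =
    (m≤m+n p (width u) , m<m+n i z<s , i+1<w↑ , junction-window-novel-w↑ split) P↑.∷
    P↑.weaken (≤-reflexive (sym (trans end≡ (trans (+-suc p (width u)) (+-comm 1 i))))) (novel-windows-w↑ (m ++ [ u ]) v C (trans split (sym (++-assoc m [ u ] (v ∷ C)))))
    where
      p = length (↑.runs (full ∷ m))
      i = p + width u
      end≡ : length (↑.runs (full ∷ m ++ [ u ])) ≡ p + suc (width u)
      end≡ = trans (↑.length-runs-++-[] (full ∷ m) u) (cong (p +_) (length-asc (low u) (width u)))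
      0<rest : 0 < length (↑.runs (v ∷ C))
      0<rest = <-≤-trans (subst (0 <_) (sym (length-asc (low v) (width v))) z<s) (length-++-≤ˡ (ascRun v))
      i+1<w↑ : i + 1 < length w↑
      i+1<w↑ = subst₂ _<_ (+-comm 1 i) (sym (↑.length-runs-split {full ∷ reverse blocks} {full ∷ m} {u} {v ∷ C} (cong (full ∷_) split)))
        (subst (_< p + (length (ascRun u) + length (↑.runs (v ∷ C)))) (+-suc p (width u))
          (+-monoʳ-< p (subst (_< length (ascRun u) + length (↑.runs (v ∷ C))) (length-asc (low u) (width u))
            (m<m+n (length (ascRun u)) 0<rest))))

  module Sizes (1≤n : 1 ≤ n) where

    first-block : ∃ λ b → ∃ λ bs → blocks ≡ b ∷ bs
    first-block = nonempty (Valid⇒∈-blocks (valid 0 0 0 1≤n (s≤s z≤n) (cells-1>0 1≤n) refl))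

    q : ℕ
    q = length (proj₁ (proj₂ first-block))

    blocks≡ : blocks ≡ proj₁ first-block ∷ proj₁ (proj₂ first-block)
    blocks≡ = proj₂ (proj₂ first-block)

    length-blocks≡ : length blocks ≡ suc q
    length-blocks≡ = cong length blocks≡

    q+2^n≡ : q + 2 ^ n ≡ n * 2 ^ (2 + n)
    q+2^n≡ = suc-injective (trans (cong (_+ 2 ^ n) (sym length-blocks≡)) (trans length-blocks (+-comm _ 1)))

    module _ {L : Str → ℕ → ℕ} (isPL : IsPhraseLength L) where
      open +-*-Solver

      count : Str → ℕ
      count w = countPhrases L w (length w) 0

      lower-w↓ : 3 * q ≤ count w↓
      lower-w↓ = ≤-trans (m≤n+m (3 * q) 2) (Greedy.windows≤greedy isPL w↓ (length w↓) 0
                  (novel-windows-w↓ [] (proj₁ first-block) (proj₁ (proj₂ first-block)) blocks≡) ≤-refl)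

      upper-w↓ : count w↓ ≤ 3 * q + (N + 4)
      upper-w↓ with factorization-w↓ [] blocks refl
      ... | φ , size≡ = ≤-trans (Greedy.greedy≤size isPL w↓ φ (length w↓) 0 z≤n) (≤-reflexive (trans size≡
            (trans (cong (λ k → 3 * k + suc N) length-blocks≡) (solve 2 (λ q m → con 3 :* (con 1 :+ q) :+ (con 1 :+ m) := con 3 :* q :+ (m :+ con 4)) refl q N))))

      lower-w↑ : q ≤ count w↑
      lower-w↑ = subst (_≤ count w↑) (suc-injective (trans (cong length (sym eq)) (trans (length-reverse blocks) length-blocks≡)))
        (Greedy.windows≤greedy isPL w↑ (length w↑) 0 (P↑.weaken z≤n (novel-windows-w↑ [] u C eq)) ≤-refl)
        where
          last-block = nonempty (reverse⁺ (∈-split {pre = []} blocks≡))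
          u = proj₁ last-block
          C = proj₁ (proj₂ last-block)
          eq = proj₂ (proj₂ last-block)

      upper-w↑ : count w↑ ≤ q + (N + 2)
      upper-w↑ with factorization-w↑ [] (reverse blocks) refl
      ... | φ , size≡ with P↑.letters (suc N) (subst P↑.Factorization start≡ φ)
        where
          start≡ : length (↑.runs (full ∷ [])) ≡ 0 + suc N
          start≡ = trans (cong length (++-identityʳ (ascRun full))) length-ascRun-full
      ...   | ψ , size≡′ = ≤-trans (Greedy.greedy≤size isPL w↑ ψ (length w↑) 0 z≤n) (≤-reflexive (trans size≡′
              (trans (cong (suc N +_) (trans (P↑.size-subst _ φ) (trans size≡ (trans (length-reverse blocks) length-blocks≡))))
                (solve 2 (λ q m → (con 1 :+ m) :+ (con 1 :+ q) := q :+ (m :+ con 2)) refl q N))))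

liminf-ratio-3 : ∀ (a b q c : ℕ → ℕ) → (∀ k → 3 * q k ≤ a k) → (∀ k → a k ≤ 3 * q k + c k) →
                 (∀ k → q k ≤ b k) → (∀ k → b k ≤ q k + c k) →
                 (∀ M → ∃[ K ] ∀ k → K ≤ k → M * c k ≤ q k) → LiminfRatio a b 3
liminf-ratio-3 a b q c 3q≤a a≤ q≤b b≤ negligible = eventually-above , often-below
  where
    open ≤-Reasoning
    eventually-above : ∀ m → 1 ≤ m → ∃[ K ] ∀ k → K ≤ k → (3 * m ∸ 1) * b k ≤ m * a k
    eventually-above m 1≤m with negligible (3 * m ∸ 1)
    ... | K , small = K , λ k K≤k → begin
      (3 * m ∸ 1) * b k                        ≤⟨ *-monoʳ-≤ (3 * m ∸ 1) (b≤ k) ⟩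
      (3 * m ∸ 1) * (q k + c k)                ≡⟨ *-distribˡ-+ (3 * m ∸ 1) (q k) (c k) ⟩
      (3 * m ∸ 1) * q k + (3 * m ∸ 1) * c k    ≤⟨ +-monoʳ-≤ ((3 * m ∸ 1) * q k) (small k K≤k) ⟩
      (3 * m ∸ 1) * q k + q k                  ≡⟨ cong ((3 * m ∸ 1) * q k +_) (sym (*-identityˡ (q k))) ⟩
      (3 * m ∸ 1) * q k + 1 * q k              ≡⟨ sym (*-distribʳ-+ (q k) (3 * m ∸ 1) 1) ⟩
      (3 * m ∸ 1 + 1) * q k                    ≡⟨ cong (_* q k) (m∸n+n≡m (≤-trans 1≤m (m≤n*m m 3))) ⟩
      (3 * m) * q k                            ≡⟨ solve 2 (λ m q → (con 3 :* m) :* q := m :* (con 3 :* q)) refl m (q k) ⟩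
      m * (3 * q k)                            ≤⟨ *-monoʳ-≤ m (3q≤a k) ⟩
      m * a k                                  ∎
      where open +-*-Solver
    often-below : ∀ m → 1 ≤ m → ∀ K → ∃[ k ] (K ≤ k × m * a k ≤ (3 * m + 1) * b k)
    often-below m _ K′ with negligible m
    ... | K , small = K′ + K , m≤m+n K′ K , (begin
      m * a k                      ≤⟨ *-monoʳ-≤ m (a≤ k) ⟩
      m * (3 * q k + c k)          ≡⟨ *-distribˡ-+ m (3 * q k) (c k) ⟩
      m * (3 * q k) + m * c k      ≤⟨ +-monoʳ-≤ (m * (3 * q k)) (small k (m≤n+m K K′)) ⟩
      m * (3 * q k) + q k          ≡⟨ solve 2 (λ m q → m :* (con 3 :* q) :+ q := (con 3 :* m :+ con 1) :* q) refl m (q k) ⟩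
      (3 * m + 1) * q k            ≤⟨ *-monoʳ-≤ (3 * m + 1) (q≤b k) ⟩
      (3 * m + 1) * b k            ∎)
      where
        open +-*-Solver
        k = K′ + K

overhead-negligible : ∀ M {n q} → q + 2 ^ n ≡ n * 2 ^ (2 + n) → 3 * M < n → M * (2 ^ (3 + n) + 4) ≤ q
overhead-negligible M {n} {q} q+X≡ 3M<n = +-cancelʳ-≤ X (M * (2 ^ (3 + n) + 4)) q (begin
  M * (2 ^ (3 + n) + 4) + X
    ≡⟨ solve 2 (λ m x → m :* (con 2 :* (con 2 :* (con 2 :* x)) :+ con 4) :+ x := (con 8 :* m :* x :+ con 4 :* m) :+ x) refl M X ⟩
  (8 * M * X + 4 * M) + X
    ≤⟨ +-monoˡ-≤ X (+-monoʳ-≤ (8 * M * X) (subst (_≤ 4 * M * X) (*-identityʳ (4 * M)) (*-monoʳ-≤ (4 * M) 1≤X))) ⟩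
  (8 * M * X + 4 * M * X) + X
    ≡⟨ solve 2 (λ m x → (con 8 :* m :* x :+ con 4 :* m :* x) :+ x := (con 12 :* m :+ con 1) :* x) refl M X ⟩
  (12 * M + 1) * X
    ≤⟨ *-monoˡ-≤ X 12M+1≤4n ⟩
  (4 * n) * X
    ≡⟨ solve 2 (λ n x → (con 4 :* n) :* x := n :* (con 2 :* (con 2 :* x))) refl n X ⟩
  n * 2 ^ (2 + n)
    ≡⟨ sym q+X≡ ⟩
  q + X                            ∎)
  where
    open ≤-Reasoning
    open +-*-Solver
    X = 2 ^ n
    1≤X : 1 ≤ X
    1≤X = m^n>0 2 n
    12M+1≤4n : 12 * M + 1 ≤ 4 * n
    12M+1≤4n = ≤-trans (+-monoʳ-≤ (12 * M) (s≤s (z≤n {3}))) (subst (_≤ 4 * n) (solve 1 (λ m → con 4 :* (con 3 :* m :+ con 1) := con 12 :* m :+ con 4) refl M) (*-monoʳ-≤ 4 (subst (_≤ n) (+-comm 1 (3 * M)) 3M<n)))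

n<2^n : ∀ n → n < 2 ^ n
n<2^n zero = s≤s z≤n
n<2^n (suc n) = subst (_≤ 2 ^ suc n) (+-comm (suc n) 1) (+-mono-≤ (n<2^n n) (subst (1 ≤_) (sym (+-identityʳ (2 ^ n))) (m^n>0 2 n)))

N<length-w↑ : ∀ n → 2 ^ (3 + n) < length (Strings.w↑ n)
N<length-w↑ n = subst (2 ^ (3 + n) <_) (trans (sym (Strings.length-w↓ n)) (trans (cong length (sym (Strings.reverse-w↑ n))) (length-reverse (Strings.w↑ n))))
  (m≤n+m (suc (2 ^ (3 + n))) _)

n<length-w↑ : ∀ n → n < length (Strings.w↑ n)
n<length-w↑ n = <-trans (<-≤-trans (n<2^n n) (^-monoʳ-≤ 2 (m≤n+m n 3))) (N<length-w↑ n)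

-- Each member has more phases than the previous one has letters, so the lengths increase.
phases : ℕ → ℕ
phases zero = 1
phases (suc k) = length (Strings.w↑ (phases k))

family : ℕ → Str
family k = Strings.w↑ (phases k)

k<phases : ∀ k → k < phases k
k<phases zero = s≤s z≤n
k<phases (suc k) = ≤-<-trans (k<phases k) (n<length-w↑ (phases k))

witness : ∀ {L} → IsPhraseLength L → Witness (λ w → countPhrases L w (length w) 0) family
witness {L} isPL = (λ k → n<length-w↑ (phases (suc k))) , positive ,
  liminf-ratio-3 a b q c 3q≤a a≤ q≤b b≤ negligible
  where
    1≤phases : ∀ k → 1 ≤ phases k
    1≤phases k = ≤-trans (s≤s z≤n) (k<phases k)
    module S (k : ℕ) = Strings.Sizes (phases k) (1≤phases k)
    count : Str → ℕ
    count w = countPhrases L w (length w) 0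
    a b q c : ℕ → ℕ
    a k = count (reverse (family k))
    b k = count (family k)
    q k = S.q k
    c k = 2 ^ (3 + phases k) + 4
    a≡ : ∀ k → a k ≡ S.count k isPL (Strings.w↓ (phases k))
    a≡ k = cong count (Strings.reverse-w↑ (phases k))
    positive : ∀ k → 1 ≤ b k
    positive k = Greedy.1≤phrases isPL (family k) (≤-trans (s≤s z≤n) (n<length-w↑ (phases k)))
    3q≤a : ∀ k → 3 * q k ≤ a k
    3q≤a k = subst (3 * q k ≤_) (sym (a≡ k)) (S.lower-w↓ k isPL)
    a≤ : ∀ k → a k ≤ 3 * q k + c k
    a≤ k = subst (_≤ 3 * q k + c k) (sym (a≡ k)) (S.upper-w↓ k isPL)
    q≤b : ∀ k → q k ≤ b k
    q≤b k = S.lower-w↑ k isPL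
    b≤ : ∀ k → b k ≤ q k + c k
    b≤ k = ≤-trans (S.upper-w↑ k isPL) (+-monoʳ-≤ (q k) (+-monoʳ-≤ (2 ^ (3 + phases k)) (s≤s (s≤s (z≤n {2})))))
    negligible : ∀ M → ∃[ K ] ∀ k → K ≤ k → M * c k ≤ q k
    negligible M = 3 * M , λ k 3M≤k → overhead-negligible M (S.q+2^n≡ k) (≤-<-trans 3M≤k (k<phases k))

proposition4p6 : (∃[ f ] Witness z f) × (∃[ f ] Witness zno f)
proposition4p6 = (family , witness isPhraseLength-longestSrc) , (family , witness isPhraseLength-longestSrcNo)
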